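{- Let $\mathbb F_q$ be a finite field of odd characteristic, ${\tt M}$ a matrix over $\mathbb F_q$ with rows indexed by a finite set $V$ and columns indexed by a finite set $E$, of rank $|V|$, and $M$ the matroid on $E$ it represents. Let $j$ be a positive integer. For ${\mathbf x}\in\mathbb F_q^V$ (a row vector) put ${\mathbf y}={\mathbf x}{\tt M}=(y_e)_{e\in E}$ and for $\alpha\in(\mathbb F_q^*)^E$ put $Q_j({\mathbf x},\alpha)=\sum_{e\in E}\alpha_e y_e^j$. For $b\in\mathbb F_q$ let $N_b(j)$ be the number of pairs $({\mathbf x},\alpha)\in\mathbb F_q^V\times(\mathbb F_q^*)^E$ with $Q_j({\mathbf x},\alpha)=b$. Then for every $b\in\mathbb F_q$ the number $N_b(j)$ does not depend on $j$, and $\chi_{M^\perp}(q)=(N_0(j)-N_1(j))/q^{|V|}$.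
   Context: $M^\perp$ is the dual matroid of $M$ (rank function $r^\perp(A)=|A|-r(E)+r(E\setminus A)$, where $r(A)$ is the rank of the columns of ${\tt M}$ indexed by $A$), and $\chi_N(x)=\sum_{A\subseteq E}(-1)^{|A|}x^{r_N(E)-r_N(A)}$ is the characteristic polynomial of a matroid $N$ on $E$ with rank function $r_N$. -}

module Defs where

open import Data.Nat using (ℕ; zero; suc; _∸_; _⊔_)
import Data.Nat as ℕ
open import Data.Integer using (ℤ; +_; -[1+_])
import Data.Integer as ℤ
open import Data.Fin using (Fin)
import Data.Fin as Fin
open import Data.Bool using (Bool; true; false; if_then_else_; _∧_; not; T?)
open import Data.List using (List; []; _∷_; map; concatMap; filter; length; foldr; allFin)
open import Data.Bool.ListAction using (all)
open import Data.Vec.Functional using () renaming (_∷_ to _∷ᶠ_)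
open import Data.Product using (Σ; ∃; _×_; _,_)
open import Function.Bundles using (_↔_; Inverse)
open import Relation.Binary.PropositionalEquality using (_≡_; _≢_; refl; cong; trans; sym)
open import Relation.Nullary using (Dec; yes; no; does; ¬_)
open import Relation.Nullary.Decidable using (map′)
open import Algebra.Structures using (IsCommutativeRing)

-- Finite fields (agda-stdlib has no fields): a commutative ring with
-- propositional equality, 0 ≠ 1, inverses of nonzero elements, and a
-- bijection with Fin size (so |F| = size = q).

record FiniteField : Set₁ where
  infixl 6 _+_
  infixl 7 _*_
  field
    Carrier : Set
    _+_ _*_ : Carrier → Carrier → Carrier
    -_      : Carrier → Carrier
    0# 1#   : Carrier
    isCommutativeRing : IsCommutativeRing _≡_ _+_ _*_ -_ 0# 1#
    0≢1     : 0# ≢ 1#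
    inverse : ∀ x → x ≢ 0# → Σ Carrier (λ y → x * y ≡ 1#)
    size    : ℕ
    enum    : Carrier ↔ Fin size

  _≟_ : (x y : Carrier) → Dec (x ≡ y)
  x ≟ y = map′ inj (cong to) (to x Fin.≟ to y)
    where
      open Inverse enum
      inj : to x ≡ to y → x ≡ y
      inj p = trans (sym (strictlyInverseʳ x)) (trans (cong from p) (strictlyInverseʳ y))

  elements : List Carrier
  elements = map (Inverse.from enum) (allFin size)

  nonzeroElements : List Carrier
  nonzeroElements = filter (λ x → Relation.Nullary.¬? (x ≟ 0#)) elements

  _^_ : Carrier → ℕ → Carrier
  x ^ zero  = 1#
  x ^ suc j = x * (x ^ j)

  ∑ : ∀ {k} → (Fin k → Carrier) → Carrier
  ∑ {k} f = foldr (λ i acc → f i + acc) 0# (allFin k)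

Elem : FiniteField → Set
Elem = FiniteField.Carrier

OddCharacteristic : FiniteField → Set
OddCharacteristic F = (1# + 1#) ≢ 0#
  where open FiniteField F

vecsOver : {A : Set} → List A → (k : ℕ) → List (Fin k → A)
vecsOver xs zero    = (λ ()) ∷ []
vecsOver xs (suc k) = concatMap (λ a → map (λ v → a ∷ᶠ v) (vecsOver xs k)) xs

SubsetE : ℕ → Set
SubsetE m = Fin m → Bool

allSubsets : (m : ℕ) → List (SubsetE m)
allSubsets m = vecsOver (true ∷ false ∷ []) m

card : ∀ {m} → SubsetE m → ℕ
card {m} A = foldr (λ e acc → (if A e then 1 else 0) ℕ.+ acc) 0 (allFin m)

complement : ∀ {m} → SubsetE m → SubsetE m
complement A e = not (A e)

fullSet : ∀ {m} → SubsetE m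
fullSet _ = true

_⊆ᵇ_ : ∀ {m} → SubsetE m → SubsetE m → Bool
_⊆ᵇ_ {m} B A = all (λ e → if B e then A e else true) (allFin m)

-- Matrices with rows indexed by V = Fin n and columns by E = Fin m

module _ (F : FiniteField) where
  open FiniteField F

  Matrix : ℕ → ℕ → Set
  Matrix n m = Fin n → Fin m → Carrier

  rowTimes : ∀ {n m} → (Fin n → Carrier) → Matrix n m → (Fin m → Carrier)
  rowTimes x M e = ∑ (λ v → x v * M v e)

  -- rank of M equals |V| = n: the rows are linearly independent
  FullRowRank : ∀ {n m} → Matrix n m → Set
  FullRowRank {n} {m} M =
    (x : Fin n → Carrier) → (∀ e → rowTimes x M e ≡ 0#) → ∀ v → x v ≡ 0#

  private
    isZeroᵇ : Carrier → Bool
    isZeroᵇ x = does (x ≟ 0#)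

  independentᵇ : ∀ {n m} → Matrix n m → SubsetE m → Bool
  independentᵇ {n} {m} M B =
    all (λ c → if supported c ∧ combZero c then allZero c else true)
        (vecsOver elements m)
    where
      supported : (Fin m → Carrier) → Bool
      supported c = all (λ e → if B e then true else isZeroᵇ (c e)) (allFin m)
      combZero : (Fin m → Carrier) → Bool
      combZero c = all (λ v → isZeroᵇ (∑ (λ e → c e * M v e))) (allFin n)
      allZero : (Fin m → Carrier) → Bool
      allZero c = all (λ e → isZeroᵇ (c e)) (allFin m)

  rank : ∀ {n m} → Matrix n m → SubsetE m → ℕ
  rank {n} {m} M A =
    foldr _⊔_ 0 (map card (filter (λ B → T? ((B ⊆ᵇ A) ∧ independentᵇ M B)) (allSubsets m)))

  Q : ∀ {n m} → Matrix n m → ℕ → (Fin n → Carrier) → (Fin m → Carrier) → Carrier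
  Q M j x α = ∑ (λ e → α e * (rowTimes x M e ^ j))

  N : ∀ {n m} → Matrix n m → Carrier → ℕ → ℕ
  N {n} {m} M b j =
    length (filter (λ xα → Data.Product.uncurry (λ x α → Q M j x α ≟ b) xα)
      (concatMap (λ x → map (λ α → (x , α)) (vecsOver nonzeroElements m))
                 (vecsOver elements n)))

dualRank : ∀ {m} → (SubsetE m → ℕ) → SubsetE m → ℕ
dualRank r A = (card A ℕ.+ r (complement A)) ∸ r fullSet

charPoly : (m : ℕ) → (SubsetE m → ℕ) → ℤ → ℤ
charPoly m rN x =
  foldr (λ A acc → (ℤ.-1ℤ ℤ.^ card A) ℤ.* (x ℤ.^ (rN fullSet ∸ rN A)) ℤ.+ acc)
        (+ 0) (allSubsets m)

-- Fix x and put y = x M.  Since y_e^j = 0 iff y_e = 0, the number of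
-- α ∈ (F^*)^E with Σ_e α_e y_e^j = b depends only on which y_e vanish, hence
-- not on j.  Solving for one coordinate of α at a time, this number is
-- A + [b = 0] D with D = Π_e (q [y_e = 0] − 1), so N_0 − N_1 = Σ_x D.
-- Expanding the product over the set S of coordinates contributing q [y_e = 0]
-- gives Σ_S (−1)^{|E∖S|} q^{|S|} #{x : x M vanishes on S}, and Gaussian
-- elimination shows that this count is q^{|V| − r(S)}.  For A = E ∖ S one has
-- |S| − r(S) = r^⊥(E) − r^⊥(A), so the sum is q^{|V|} χ_{M^⊥}(q).

module Submission where

open import Defs
open import Algebra.Bundles using (CommutativeRing; Monoid)
open import Algebra.Solver.Ring.AlmostCommutativeRing using (fromCommutativeRing; _-Raw-AlmostCommutative⟶_)
open import Algebra.Structures using (IsCommutativeRing)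
open import Data.Bool using (Bool; true; false; if_then_else_; _∧_; not; T; T?)
open import Data.Bool.ListAction using (all)
import Data.Bool.Properties as Boolₚ
open import Data.Empty using (⊥-elim)
open import Data.Fin using (Fin; zero; suc)
import Data.Fin as Fin
import Data.Fin.Properties as Finₚ
open import Data.Integer as ℤ using (ℤ; 0ℤ; 1ℤ; -1ℤ; -[1+_]) renaming (+_ to pos)
import Data.Integer.Properties as ℤₚ
open import Data.Integer.Tactic.RingSolver using (solve-∀)
open import Data.List using (List; []; _∷_; _++_; map; concatMap; filter; length; foldr; allFin)
open import Data.List.Membership.Propositional using (_∈_; lose)
open import Data.List.Membership.Propositional.Properties using (∈-concatMap⁺; ∈-map⁺; ∈-allFin)
import Data.List.Properties as Listₚ
open import Data.List.Relation.Unary.Any using (here; there)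
open import Data.Maybe using (Maybe; just; nothing)
open import Data.Nat as ℕ using (ℕ; zero; suc; _≤_; z≤n; s≤s; _∸_; _⊔_)
import Data.Nat.Properties as ℕₚ
open import Data.Product using (Σ; _×_; _,_; proj₁; proj₂; uncurry)
open import Data.Sum using (_⊎_; inj₁; inj₂)
open import Data.Vec.Functional using () renaming (_∷_ to _∷ᶠ_)
open import Function.Bundles using (Inverse; Equivalence; mk⇔)
open import Level using (0ℓ)
open import Relation.Binary.PropositionalEquality
open import Relation.Nullary using (Dec; yes; no; does; ¬_; ¬?)
open import Relation.Nullary.Decidable using (_×-dec_; does-⇔; dec-true; dec-false; decidable-stable)
open import Relation.Unary using (Pred; Decidable)

module IntegerSum where

  open import Data.Integer using (_+_; _*_; -_; _-_)

  sumℤ : {A : Set} → List A → (A → ℤ) → ℤ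
  sumℤ []       f = 0ℤ
  sumℤ (x ∷ xs) f = f x + sumℤ xs f

  𝟙 : {P : Set} → Dec P → ℤ
  𝟙 d = if does d then 1ℤ else 0ℤ

  𝟙-⇔ : {P Q : Set} → (P → Q) → (Q → P) → (p : Dec P) (q : Dec Q) → 𝟙 p ≡ 𝟙 q
  𝟙-⇔ f g p q = cong (λ b → if b then 1ℤ else 0ℤ) (does-⇔ (mk⇔ f g) p q)

  𝟙-yes : {P : Set} (d : Dec P) → P → 𝟙 d ≡ 1ℤ
  𝟙-yes d p = cong (λ b → if b then 1ℤ else 0ℤ) (dec-true d p)

  𝟙-no : {P : Set} (d : Dec P) → ¬ P → 𝟙 d ≡ 0ℤ
  𝟙-no d ¬p = cong (λ b → if b then 1ℤ else 0ℤ) (dec-false d ¬p)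

  𝟙-¬ : {P : Set} (d : Dec P) → 𝟙 (¬? d) ≡ 1ℤ - 𝟙 d
  𝟙-¬ (yes _) = refl
  𝟙-¬ (no _)  = refl

  𝟙*-cong : {P : Set} (d : Dec P) {X Y : ℤ} → (P → X ≡ Y) → 𝟙 d * X ≡ 𝟙 d * Y
  𝟙*-cong (yes p) X≡Y = cong (1ℤ *_) (X≡Y p)
  𝟙*-cong (no _)  _   = refl

  module _ {A : Set} where

    sumℤ-cong : (xs : List A) {f g : A → ℤ} → (∀ x → f x ≡ g x) → sumℤ xs f ≡ sumℤ xs g
    sumℤ-cong []       eq = refl
    sumℤ-cong (x ∷ xs) eq = cong₂ _+_ (eq x) (sumℤ-cong xs eq)

    sumℤ-++ : (xs ys : List A) (f : A → ℤ) → sumℤ (xs ++ ys) f ≡ sumℤ xs f + sumℤ ys f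
    sumℤ-++ []       ys f = sym (ℤₚ.+-identityˡ _)
    sumℤ-++ (x ∷ xs) ys f = trans (cong (f x +_) (sumℤ-++ xs ys f)) (sym (ℤₚ.+-assoc (f x) _ _))

    sumℤ-+ : (xs : List A) (f g : A → ℤ) → sumℤ xs (λ x → f x + g x) ≡ sumℤ xs f + sumℤ xs g
    sumℤ-+ []       f g = refl
    sumℤ-+ (x ∷ xs) f g = trans (cong ((f x + g x) +_) (sumℤ-+ xs f g)) (interchange (f x) (g x) _ _)
      where open import Algebra.Properties.CommutativeSemigroup ℤₚ.+-commutativeSemigroup using (interchange)

    sumℤ-*ˡ : (xs : List A) (c : ℤ) (f : A → ℤ) → sumℤ xs (λ x → c * f x) ≡ c * sumℤ xs f
    sumℤ-*ˡ []       c f = sym (ℤₚ.*-zeroʳ c)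
    sumℤ-*ˡ (x ∷ xs) c f = trans (cong (c * f x +_) (sumℤ-*ˡ xs c f)) (sym (ℤₚ.*-distribˡ-+ c _ _))

    sumℤ-*ʳ : (xs : List A) (c : ℤ) (f : A → ℤ) → sumℤ xs (λ x → f x * c) ≡ sumℤ xs f * c
    sumℤ-*ʳ xs c f = trans (sumℤ-cong xs (λ x → ℤₚ.*-comm (f x) c))
                           (trans (sumℤ-*ˡ xs c f) (ℤₚ.*-comm c _))

    sumℤ-- : (xs : List A) (f g : A → ℤ) → sumℤ xs (λ x → f x - g x) ≡ sumℤ xs f - sumℤ xs g
    sumℤ-- xs f g = trans (sumℤ-+ xs f (λ x → - g x)) (cong (sumℤ xs f +_) sumℤ-neg)
      where
        sumℤ-neg : sumℤ xs (λ x → - g x) ≡ - sumℤ xs g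
        sumℤ-neg = trans (sumℤ-cong xs (λ x → sym (ℤₚ.-1*i≡-i (g x))))
                         (trans (sumℤ-*ˡ xs (- 1ℤ) g) (ℤₚ.-1*i≡-i _))

    sumℤ-const : (xs : List A) (c : ℤ) → sumℤ xs (λ _ → c) ≡ pos (length xs) * c
    sumℤ-const []       c = sym (ℤₚ.*-zeroˡ c)
    sumℤ-const (x ∷ xs) c = trans (cong (c +_) (sumℤ-const xs c))
      (trans (cong (_+ pos (length xs) * c) (sym (ℤₚ.*-identityˡ c)))
             (sym (ℤₚ.*-distribʳ-+ c 1ℤ (pos (length xs)))))

    sumℤ-zero : (xs : List A) (f : A → ℤ) → (∀ x → f x ≡ 0ℤ) → sumℤ xs f ≡ 0ℤ
    sumℤ-zero xs f eq = trans (sumℤ-cong xs eq) (trans (sumℤ-const xs 0ℤ) (ℤₚ.*-zeroʳ (pos (length xs))))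

    length-filter≡sumℤ-𝟙 : {P : Pred A 0ℓ} (P? : Decidable P) (xs : List A) →
                           pos (length (filter P? xs)) ≡ sumℤ xs (λ x → 𝟙 (P? x))
    length-filter≡sumℤ-𝟙 P? []       = refl
    length-filter≡sumℤ-𝟙 P? (x ∷ xs) with does (P? x)
    ... | false = trans (length-filter≡sumℤ-𝟙 P? xs) (sym (ℤₚ.+-identityˡ _))
    ... | true  = trans (sym (ℤₚ.pos-+ 1 (length (filter P? xs))))
                        (cong (1ℤ +_) (length-filter≡sumℤ-𝟙 P? xs))

    sumℤ-filter : {P : Pred A 0ℓ} (P? : Decidable P) (xs : List A) (f : A → ℤ) →
                  sumℤ (filter P? xs) f ≡ sumℤ xs (λ x → 𝟙 (P? x) * f x)
    sumℤ-filter P? []       f = refl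
    sumℤ-filter P? (x ∷ xs) f with does (P? x)
    ... | false = trans (sumℤ-filter P? xs f) (sym (ℤₚ.+-identityˡ _))
    ... | true  = cong₂ _+_ (sym (ℤₚ.*-identityˡ (f x))) (sumℤ-filter P? xs f)

  module _ {A B : Set} where

    sumℤ-map : (g : A → B) (xs : List A) (f : B → ℤ) → sumℤ (map g xs) f ≡ sumℤ xs (λ x → f (g x))
    sumℤ-map g []       f = refl
    sumℤ-map g (x ∷ xs) f = cong (f (g x) +_) (sumℤ-map g xs f)

    sumℤ-concatMap : (g : A → List B) (xs : List A) (f : B → ℤ) →
                     sumℤ (concatMap g xs) f ≡ sumℤ xs (λ x → sumℤ (g x) f)
    sumℤ-concatMap g []       f = refl
    sumℤ-concatMap g (x ∷ xs) f = trans (sumℤ-++ (g x) (concatMap g xs) f)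
                                        (cong (sumℤ (g x) f +_) (sumℤ-concatMap g xs f))

    sumℤ-comm : (xs : List A) (ys : List B) (f : A → B → ℤ) →
                sumℤ xs (λ x → sumℤ ys (f x)) ≡ sumℤ ys (λ y → sumℤ xs (λ x → f x y))
    sumℤ-comm []       ys f = sym (sumℤ-zero ys _ (λ _ → refl))
    sumℤ-comm (x ∷ xs) ys f = trans (cong (sumℤ ys (f x) +_) (sumℤ-comm xs ys f))
                                    (sym (sumℤ-+ ys (f x) (λ y → sumℤ xs (λ x → f x y))))

  sumℤ-vecsOver : {A : Set} (xs : List A) (k : ℕ) (f : (Fin (suc k) → A) → ℤ) →
                  sumℤ (vecsOver xs (suc k)) f ≡ sumℤ xs (λ a → sumℤ (vecsOver xs k) (λ v → f (a ∷ᶠ v)))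
  sumℤ-vecsOver xs k f = trans (sumℤ-concatMap _ xs f)
                               (sumℤ-cong xs (λ a → sumℤ-map (a ∷ᶠ_) (vecsOver xs k) f))

  foldr≡sumℤ : {A : Set} (xs : List A) (g : A → ℤ) → foldr (λ a acc → g a + acc) 0ℤ xs ≡ sumℤ xs g
  foldr≡sumℤ []       g = refl
  foldr≡sumℤ (x ∷ xs) g = cong (g x +_) (foldr≡sumℤ xs g)

open IntegerSum

module ListLemmas where

  foldr-allFin-suc : {A : Set} {k : ℕ} (f : Fin (suc k) → A → A) (e : A) →
                     foldr f e (allFin (suc k)) ≡ f zero (foldr (λ i → f (suc i)) e (allFin k))
  foldr-allFin-suc {k = k} f e =
    cong (f zero) (trans (cong (foldr f e) (sym (Listₚ.map-tabulate (λ i → i) suc))) (Listₚ.foldr-map f suc e (allFin k)))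

  ∧≡true⇒ : ∀ a b → a ∧ b ≡ true → a ≡ true × b ≡ true
  ∧≡true⇒ true true _ = refl , refl

  ∧≡true⇐ : ∀ {a b} → a ≡ true → b ≡ true → a ∧ b ≡ true
  ∧≡true⇐ refl refl = refl

  module _ {A : Set} where

    all-sound : (p : A → Bool) (xs : List A) → all p xs ≡ true → ∀ {x} → x ∈ xs → p x ≡ true
    all-sound p (y ∷ ys) h (here refl) = proj₁ (∧≡true⇒ (p y) _ h)
    all-sound p (y ∷ ys) h (there x∈) = all-sound p ys (proj₂ (∧≡true⇒ (p y) _ h)) x∈

    all-complete : (p : A → Bool) (xs : List A) → (∀ x → p x ≡ true) → all p xs ≡ true
    all-complete p []       h = refl
    all-complete p (y ∷ ys) h = ∧≡true⇐ (h y) (all-complete p ys h)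

    all≡false⇒counterexample : (p : A → Bool) (xs : List A) → all p xs ≡ false → Σ A (λ x → p x ≡ false)
    all≡false⇒counterexample p (y ∷ ys) h with p y in eq
    ... | false = y , eq
    ... | true  = all≡false⇒counterexample p ys h

    ∈-vecsOver : (xs : List A) (k : ℕ) (f : Fin k → A) → (∀ i → f i ∈ xs) →
                 Σ (Fin k → A) (λ g → g ∈ vecsOver xs k × (∀ i → g i ≡ f i))
    ∈-vecsOver xs zero    f f∈ = (λ ()) , here refl , (λ ())
    ∈-vecsOver xs (suc k) f f∈ with ∈-vecsOver xs k (λ i → f (suc i)) (λ i → f∈ (suc i))
    ... | g , g∈ , g≗ = f zero ∷ᶠ g , head∷g∈ , pointwise
      where
        head∷g∈ : (f zero ∷ᶠ g) ∈ vecsOver xs (suc k)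
        head∷g∈ = ∈-concatMap⁺ (λ a → map (a ∷ᶠ_) (vecsOver xs k)) (lose (f∈ zero) (∈-map⁺ (f zero ∷ᶠ_) g∈))
        pointwise : ∀ i → (f zero ∷ᶠ g) i ≡ f i
        pointwise zero    = refl
        pointwise (suc i) = g≗ i

  module Maximum {A : Set} {P : Pred A 0ℓ} (P? : Decidable P) (c : A → ℕ) where

    maxOver : List A → ℕ
    maxOver xs = foldr _⊔_ 0 (map c (filter P? xs))

    ≤-maxOver : ∀ xs {x} → x ∈ xs → P x → c x ≤ maxOver xs
    ≤-maxOver (y ∷ ys) x∈ px with P? y
    ≤-maxOver (y ∷ ys) (here refl) px | yes _  = ℕₚ.m≤m⊔n (c y) _
    ≤-maxOver (y ∷ ys) (there x∈)  px | yes _  = ℕₚ.≤-trans (≤-maxOver ys x∈ px) (ℕₚ.m≤n⊔m (c y) _)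
    ≤-maxOver (y ∷ ys) (here refl) px | no ¬py = ⊥-elim (¬py px)
    ≤-maxOver (y ∷ ys) (there x∈)  px | no _   = ≤-maxOver ys x∈ px

    private
      maxOver≡0-or-attained : ∀ xs → maxOver xs ≡ 0 ⊎ Σ A (λ y → y ∈ xs × P y × c y ≡ maxOver xs)
      maxOver≡0-or-attained [] = inj₁ refl
      maxOver≡0-or-attained (y ∷ ys) with P? y
      ... | no _ with maxOver≡0-or-attained ys
      ...   | inj₁ z = inj₁ z
      ...   | inj₂ (z , z∈ , pz , cz) = inj₂ (z , there z∈ , pz , cz)
      maxOver≡0-or-attained (y ∷ ys) | yes py with ℕₚ.≤-total (maxOver ys) (c y)
      ... | inj₁ ≤cy = inj₂ (y , here refl , py , sym (ℕₚ.m≥n⇒m⊔n≡m ≤cy))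
      ... | inj₂ cy≤ with maxOver≡0-or-attained ys
      ...   | inj₁ z = inj₁ (trans (ℕₚ.m≤n⇒m⊔n≡n cy≤) z)
      ...   | inj₂ (z , z∈ , pz , cz) = inj₂ (z , there z∈ , pz , trans cz (sym (ℕₚ.m≤n⇒m⊔n≡n cy≤)))

    maxOver-attained : ∀ xs {x} → x ∈ xs → P x → Σ A (λ y → y ∈ xs × P y × c y ≡ maxOver xs)
    maxOver-attained xs {x} x∈ px with maxOver≡0-or-attained xs
    ... | inj₂ r = r
    ... | inj₁ z = x , x∈ , px , trans (ℕₚ.n≤0⇒n≡0 (subst (c x ≤_) z (≤-maxOver xs x∈ px))) (sym z)

open ListLemmas

module Subsets where

  private
    count : Bool → ℕ
    count b = if b then 1 else 0

  _∖｛_｝ : ∀ {m} → SubsetE m → Fin m → SubsetE m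
  (S ∖｛ p ｝) e = if does (e Fin.≟ p) then false else S e

  _∪｛_｝ : ∀ {m} → SubsetE m → Fin m → SubsetE m
  (S ∪｛ p ｝) e = if does (e Fin.≟ p) then true else S e

  ∖｛｝-self : ∀ {m} (p : Fin m) S → (S ∖｛ p ｝) p ≡ false
  ∖｛｝-self p S with p Fin.≟ p
  ... | yes _  = refl
  ... | no p≢p = ⊥-elim (p≢p refl)

  ∖｛｝-false : ∀ {m} (p : Fin m) S e → S e ≡ false → (S ∖｛ p ｝) e ≡ false
  ∖｛｝-false p S e Se≡false with e Fin.≟ p
  ... | yes _ = refl
  ... | no _  = Se≡false

  ∪｛｝-self : ∀ {m} (p : Fin m) S → (S ∪｛ p ｝) p ≡ true
  ∪｛｝-self p S with p Fin.≟ p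
  ... | yes _  = refl
  ... | no p≢p = ⊥-elim (p≢p refl)

  ∪｛｝-other : ∀ {m} (p : Fin m) S {e} → e ≢ p → (S ∪｛ p ｝) e ≡ S e
  ∪｛｝-other p S {e} e≢p with e Fin.≟ p
  ... | yes e≡p = ⊥-elim (e≢p e≡p)
  ... | no _    = refl

  ∪｛｝∖｛｝ : ∀ {m} (p : Fin m) S → S p ≡ false → ∀ e → ((S ∪｛ p ｝) ∖｛ p ｝) e ≡ S e
  ∪｛｝∖｛｝ p S Sp≡false e with e Fin.≟ p
  ... | yes refl = sym Sp≡false
  ... | no _     = refl

  _⊆_ : ∀ {m} → SubsetE m → SubsetE m → Set
  B ⊆ A = ∀ e → B e ≡ true → A e ≡ true

  ⊆ᵇ-sound : ∀ {m} (B A : SubsetE m) → (B ⊆ᵇ A) ≡ true → B ⊆ A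
  ⊆ᵇ-sound {m} B A h e Be = subst (λ b → (if b then A e else true) ≡ true) Be (all-sound _ (allFin m) h (∈-allFin e))

  ⊆ᵇ-complete : ∀ {m} (B A : SubsetE m) → B ⊆ A → (B ⊆ᵇ A) ≡ true
  ⊆ᵇ-complete {m} B A h = all-complete _ (allFin m) pointwise
    where
      pointwise : ∀ e → (if B e then A e else true) ≡ true
      pointwise e with B e in eq
      ... | true  = h e eq
      ... | false = refl

  card-suc : ∀ {m} (A : SubsetE (suc m)) → card A ≡ count (A zero) ℕ.+ card (λ e → A (suc e))
  card-suc A = foldr-allFin-suc (λ e acc → count (A e) ℕ.+ acc) 0

  card-cong : ∀ {m} (A B : SubsetE m) → (∀ e → A e ≡ B e) → card A ≡ card B
  card-cong {zero}  A B h = refl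
  card-cong {suc m} A B h = trans (card-suc A) (trans (cong₂ (λ b k → count b ℕ.+ k) (h zero)
    (card-cong _ _ (λ e → h (suc e)))) (sym (card-suc B)))

  card-empty : ∀ {m} (A : SubsetE m) → (∀ e → A e ≡ false) → card A ≡ 0
  card-empty {zero}  A h = refl
  card-empty {suc m} A h = trans (card-suc A) (cong₂ (λ b k → count b ℕ.+ k) (h zero) (card-empty _ (λ e → h (suc e))))

  card-fullSet : ∀ m → card {m} fullSet ≡ m
  card-fullSet zero    = refl
  card-fullSet (suc m) = trans (card-suc {m} fullSet) (cong suc (card-fullSet m))

  card-complement : ∀ {m} (B : SubsetE m) → card B ℕ.+ card (complement B) ≡ m
  card-complement {zero}  B = refl
  card-complement {suc m} B = trans (cong₂ ℕ._+_ (card-suc B) (card-suc (complement B)))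
    (trans (regroup (B zero)) (cong suc (card-complement (λ e → B (suc e)))))
    where
      regroup : ∀ b → (count b ℕ.+ card (λ e → B (suc e))) ℕ.+ (count (not b) ℕ.+ card (λ e → complement B (suc e)))
                      ≡ suc (card (λ e → B (suc e)) ℕ.+ card (complement (λ e → B (suc e))))
      regroup true  = refl
      regroup false = ℕₚ.+-suc _ _

  card-∖｛｝ : ∀ {m} (p : Fin m) (S : SubsetE m) → S p ≡ true → card S ≡ suc (card (S ∖｛ p ｝))
  card-∖｛｝ {suc m} zero S Sp = trans (card-suc S) (trans (cong (λ b → count b ℕ.+ card (λ e → S (suc e))) Sp)
    (cong suc (sym (card-suc (S ∖｛ zero ｝)))))
  card-∖｛｝ {suc m} (suc p) S Sp = trans (card-suc S) (trans (cong (count (S zero) ℕ.+_) (card-∖｛｝ p (λ e → S (suc e)) Sp))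
    (trans (ℕₚ.+-suc (count (S zero)) _) (cong suc (sym (card-suc (S ∖｛ suc p ｝))))))

  card-mono : ∀ {m} (A B : SubsetE m) → A ⊆ B → card A ≤ card B
  card-mono {zero}  A B h = z≤n
  card-mono {suc m} A B h = subst₂ _≤_ (sym (card-suc A)) (sym (card-suc B))
    (ℕₚ.+-mono-≤ (head≤ (A zero) refl) (card-mono _ _ (λ e → h (suc e))))
    where
      head≤ : ∀ a → A zero ≡ a → count a ≤ count (B zero)
      head≤ false _  = z≤n
      head≤ true  eq = subst (λ b → 1 ≤ count b) (sym (h zero eq)) (s≤s z≤n)

  card≤card+card∖ : ∀ {m} (I B : SubsetE m) → card I ≤ card B ℕ.+ card (λ f → I f ∧ not (B f))
  card≤card+card∖ {zero}  I B = z≤n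
  card≤card+card∖ {suc m} I B = begin
    card I                                                ≡⟨ card-suc I ⟩
    count (I zero) ℕ.+ card I′                            ≤⟨ ℕₚ.+-mono-≤ (head≤ (I zero) (B zero)) (card≤card+card∖ I′ B′) ⟩
    (count (B zero) ℕ.+ count (I zero ∧ not (B zero))) ℕ.+ (card B′ ℕ.+ card (λ f → I′ f ∧ not (B′ f)))
                                                          ≡⟨ interchange (count (B zero)) _ _ _ ⟩
    (count (B zero) ℕ.+ card B′) ℕ.+ (count (I zero ∧ not (B zero)) ℕ.+ card (λ f → I′ f ∧ not (B′ f)))
                                                          ≡⟨ sym (cong₂ ℕ._+_ (card-suc B) (card-suc (λ f → I f ∧ not (B f)))) ⟩
    card B ℕ.+ card (λ f → I f ∧ not (B f)) ∎
    where
      open ℕₚ.≤-Reasoning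
      I′ B′ : SubsetE m
      I′ e = I (suc e)
      B′ e = B (suc e)
      head≤ : ∀ i b → count i ≤ count b ℕ.+ count (i ∧ not b)
      head≤ false b     = z≤n
      head≤ true  true  = s≤s z≤n
      head≤ true  false = s≤s z≤n
      open import Algebra.Properties.CommutativeSemigroup ℕₚ.+-commutativeSemigroup using (interchange)

open Subsets

-- The ring solver needs a coefficient ring whose equality computes; for an
-- abstract field that is ℤ, through its canonical homomorphism.
module IntegerRingSolver {R : Set} {add mul : R → R → R} {neg : R → R} {0ᴿ 1ᴿ : R}
                         (isCommutativeRing : IsCommutativeRing _≡_ add mul neg 0ᴿ 1ᴿ) where

  commutativeRing : CommutativeRing 0ℓ 0ℓ
  commutativeRing = record { isCommutativeRing = isCommutativeRing }

  open CommutativeRing commutativeRing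
    using (_+_; _*_; -_; 0#; 1#; +-monoid; semiring; ring; +-group; +-abelianGroup; +-identityʳ; +-comm)
  open import Algebra.Definitions.RawMonoid (Monoid.rawMonoid +-monoid) using () renaming (_×_ to _×′_)
  open import Algebra.Properties.Monoid.Mult +-monoid using (×-homo-+)
  open import Algebra.Properties.Semiring.Mult semiring using (×1-homo-*)
  open import Algebra.Properties.Ring ring using (-‿distribˡ-*; -‿distribʳ-*)
  open import Algebra.Properties.Group +-group using (⁻¹-involutive; ε⁻¹≈ε)
  open import Algebra.Properties.AbelianGroup +-abelianGroup using (⁻¹-∙-comm)
  open import Algebra.Properties.CommutativeSemigroup
    (CommutativeRing.+-commutativeSemigroup commutativeRing) using (interchange)
  open ≡-Reasoning

  ⟦_⟧ : ℤ → R
  ⟦ pos n ⟧    = n ×′ 1#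
  ⟦ -[1+ n ] ⟧ = - (suc n ×′ 1#)

  private
    ⟦-⟧ : ∀ i → ⟦ ℤ.- i ⟧ ≡ - ⟦ i ⟧
    ⟦-⟧ (pos zero)    = sym ε⁻¹≈ε
    ⟦-⟧ (pos (suc n)) = refl
    ⟦-⟧ -[1+ n ]      = sym (⁻¹-involutive _)

    ⟦⊖⟧ : ∀ m n → ⟦ m ℤ.⊖ n ⟧ ≡ m ×′ 1# + - (n ×′ 1#)
    ⟦⊖⟧ m zero = trans (cong ⟦_⟧ (ℤₚ.⊖-≥ {m} {0} z≤n))
      (sym (trans (cong ((m ×′ 1#) +_) ε⁻¹≈ε) (+-identityʳ _)))
    ⟦⊖⟧ zero (suc n) = sym (CommutativeRing.+-identityˡ commutativeRing _)
    ⟦⊖⟧ (suc m) (suc n) = begin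
      ⟦ suc m ℤ.⊖ suc n ⟧                    ≡⟨ cong ⟦_⟧ (ℤₚ.[1+m]⊖[1+n]≡m⊖n m n) ⟩
      ⟦ m ℤ.⊖ n ⟧                            ≡⟨ ⟦⊖⟧ m n ⟩
      m ×′ 1# + - (n ×′ 1#)                    ≡⟨ cong (_+ - (n ×′ 1#)) (sym (CommutativeRing.+-identityˡ commutativeRing _)) ⟩
      (0# + m ×′ 1#) + - (n ×′ 1#)             ≡⟨ cong (λ z → (z + m ×′ 1#) + - (n ×′ 1#)) (sym (CommutativeRing.-‿inverseʳ commutativeRing 1#)) ⟩
      ((1# + - 1#) + m ×′ 1#) + - (n ×′ 1#)    ≡⟨ cong (_+ - (n ×′ 1#)) (interchange′ 1# (- 1#) (m ×′ 1#)) ⟩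
      (1# + m ×′ 1#) + - 1# + - (n ×′ 1#)      ≡⟨ CommutativeRing.+-assoc commutativeRing _ _ _ ⟩
      (1# + m ×′ 1#) + (- 1# + - (n ×′ 1#))    ≡⟨ cong ((1# + m ×′ 1#) +_) (⁻¹-∙-comm 1# (n ×′ 1#)) ⟩
      (1# + m ×′ 1#) + - (1# + n ×′ 1#) ∎
      where
        interchange′ : ∀ a b c → (a + b) + c ≡ (a + c) + b
        interchange′ a b c = trans (CommutativeRing.+-assoc commutativeRing a b c)
          (trans (cong (a +_) (+-comm b c)) (sym (CommutativeRing.+-assoc commutativeRing a c b)))

    ⟦+⟧ : ∀ i j → ⟦ i ℤ.+ j ⟧ ≡ ⟦ i ⟧ + ⟦ j ⟧
    ⟦+⟧ (pos m)  (pos n)  = ×-homo-+ 1# m n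
    ⟦+⟧ (pos m)  -[1+ n ] = ⟦⊖⟧ m (suc n)
    ⟦+⟧ -[1+ m ] (pos n)  = trans (⟦⊖⟧ n (suc m)) (+-comm _ _)
    ⟦+⟧ -[1+ m ] -[1+ n ] = begin
      - (suc (suc (m ℕ.+ n)) ×′ 1#)          ≡⟨ cong (λ k → - (k ×′ 1#)) (sym (ℕₚ.+-suc (suc m) n)) ⟩
      - ((suc m ℕ.+ suc n) ×′ 1#)            ≡⟨ cong -_ (×-homo-+ 1# (suc m) (suc n)) ⟩
      - (suc m ×′ 1# + suc n ×′ 1#)           ≡⟨ sym (⁻¹-∙-comm _ _) ⟩
      - (suc m ×′ 1#) + - (suc n ×′ 1#) ∎

    ⟦*⟧ : ∀ i j → ⟦ i ℤ.* j ⟧ ≡ ⟦ i ⟧ * ⟦ j ⟧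
    ⟦*⟧ (pos m) (pos n) = trans (cong ⟦_⟧ (ℤₚ.+◃n≡+n (m ℕ.* n))) (×1-homo-* m n)
    ⟦*⟧ (pos m) -[1+ n ] = begin
      ⟦ pos m ℤ.* -[1+ n ] ⟧                           ≡⟨ cong ⟦_⟧ (ℤₚ.-◃n≡-n (m ℕ.* suc n)) ⟩
      ⟦ ℤ.- pos (m ℕ.* suc n) ⟧                         ≡⟨ ⟦-⟧ (pos (m ℕ.* suc n)) ⟩
      - ((m ℕ.* suc n) ×′ 1#)                            ≡⟨ cong -_ (×1-homo-* m (suc n)) ⟩
      - ((m ×′ 1#) * (suc n ×′ 1#))                       ≡⟨ -‿distribʳ-* _ _ ⟩
      (m ×′ 1#) * - (suc n ×′ 1#) ∎
    ⟦*⟧ -[1+ m ] (pos n) = trans (cong ⟦_⟧ (ℤₚ.-◃n≡-n (suc m ℕ.* n)))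
      (trans (⟦-⟧ (pos (suc m ℕ.* n))) (trans (cong -_ (×1-homo-* (suc m) n)) (-‿distribˡ-* _ _)))
    ⟦*⟧ -[1+ m ] -[1+ n ] = trans (×1-homo-* (suc m) (suc n))
      (trans (sym (cong (_* (suc n ×′ 1#)) (⁻¹-involutive _))) (trans (sym (-‿distribˡ-* _ _)) (-‿distribʳ-* _ _)))

  ℤ-homomorphism : ℤ.+-*-rawRing -Raw-AlmostCommutative⟶ fromCommutativeRing commutativeRing
  ℤ-homomorphism = record
    { ⟦_⟧    = ⟦_⟧
    ; +-homo = ⟦+⟧
    ; *-homo = ⟦*⟧
    ; -‿homo = ⟦-⟧
    ; 0-homo = refl
    ; 1-homo = +-identityʳ 1#
    }

  private
    ⟦⟧-weaklyDecidable : ∀ i j → Maybe (⟦ i ⟧ ≡ ⟦ j ⟧)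
    ⟦⟧-weaklyDecidable i j with i ℤ.≟ j
    ... | yes i≡j = just (cong ⟦_⟧ i≡j)
    ... | no  _   = nothing

  open import Algebra.Solver.Ring ℤ.+-*-rawRing (fromCommutativeRing commutativeRing)
    ℤ-homomorphism ⟦⟧-weaklyDecidable public
    using (solve; _:+_; _:*_; :-_; _:-_; _:=_; con)

module FieldLemmas (F : FiniteField) where

  open FiniteField F public
  open IsCommutativeRing isCommutativeRing public
    using (*-assoc; *-comm; distribˡ; distribʳ; +-identityˡ; +-identityʳ;
           *-identityˡ; *-identityʳ; zeroˡ; zeroʳ; -‿inverseʳ)
  open IntegerRingSolver isCommutativeRing public using (solve; _:+_; _:*_; :-_; _:-_; _:=_; con)
  open IntegerRingSolver isCommutativeRing using (commutativeRing)
  open import Algebra.Properties.AbelianGroup (CommutativeRing.+-abelianGroup commutativeRing) using (⁻¹-∙-comm)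
  open import Algebra.Properties.Group (CommutativeRing.+-group commutativeRing)
    using (ε⁻¹≈ε; inverseˡ-unique) renaming (x∙y⁻¹≈ε⇒x≈y to x-y≡0⇒x≡y) public

  infixl 6 _-_
  _-_ : Carrier → Carrier → Carrier
  x - y = x + - y

  ∑-suc : ∀ {k} (f : Fin (suc k) → Carrier) → ∑ f ≡ f zero + ∑ (λ i → f (suc i))
  ∑-suc f = foldr-allFin-suc (λ i acc → f i + acc) 0#

  ∑-cong : ∀ {k} {f g : Fin k → Carrier} → (∀ i → f i ≡ g i) → ∑ f ≡ ∑ g
  ∑-cong {zero}          eq = refl
  ∑-cong {suc k} {f} {g} eq =
    trans (∑-suc f) (trans (cong₂ _+_ (eq zero) (∑-cong (λ i → eq (suc i)))) (sym (∑-suc g)))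

  ∑-zero : ∀ {k} (f : Fin k → Carrier) → (∀ i → f i ≡ 0#) → ∑ f ≡ 0#
  ∑-zero {zero}  f eq = refl
  ∑-zero {suc k} f eq =
    trans (∑-suc f) (trans (cong₂ _+_ (eq zero) (∑-zero _ (λ i → eq (suc i)))) (+-identityˡ 0#))

  ∑-+ : ∀ {k} (f g : Fin k → Carrier) → ∑ (λ i → f i + g i) ≡ ∑ f + ∑ g
  ∑-+ {zero}  f g = sym (+-identityˡ 0#)
  ∑-+ {suc k} f g = begin
    ∑ (λ i → f i + g i)                      ≡⟨ ∑-suc (λ i → f i + g i) ⟩
    (f zero + g zero) + ∑ (λ i → f′ i + g′ i) ≡⟨ cong ((f zero + g zero) +_) (∑-+ f′ g′) ⟩
    (f zero + g zero) + (∑ f′ + ∑ g′)        ≡⟨ interchange (f zero) (g zero) _ _ ⟩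
    (f zero + ∑ f′) + (g zero + ∑ g′)        ≡⟨ sym (cong₂ _+_ (∑-suc f) (∑-suc g)) ⟩
    ∑ f + ∑ g ∎
    where
      open ≡-Reasoning
      open import Algebra.Properties.CommutativeSemigroup (CommutativeRing.+-commutativeSemigroup commutativeRing)
        using (interchange)
      f′ g′ : Fin k → Carrier
      f′ i = f (suc i)
      g′ i = g (suc i)

  ∑-*ˡ : ∀ {k} (c : Carrier) (f : Fin k → Carrier) → ∑ (λ i → c * f i) ≡ c * ∑ f
  ∑-*ˡ {zero}  c f = sym (zeroʳ c)
  ∑-*ˡ {suc k} c f = trans (∑-suc (λ i → c * f i)) (trans (cong (c * f zero +_) (∑-*ˡ c (λ i → f (suc i))))
    (trans (sym (distribˡ c _ _)) (cong (c *_) (sym (∑-suc f)))))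

  ∑-*ʳ : ∀ {k} (c : Carrier) (f : Fin k → Carrier) → ∑ (λ i → f i * c) ≡ ∑ f * c
  ∑-*ʳ c f = trans (∑-cong (λ i → *-comm (f i) c)) (trans (∑-*ˡ c f) (*-comm c _))

  ∑-neg : ∀ {k} (f : Fin k → Carrier) → ∑ (λ i → - f i) ≡ - ∑ f
  ∑-neg {zero}  f = sym ε⁻¹≈ε
  ∑-neg {suc k} f = trans (∑-suc (λ i → - f i)) (trans (cong (- f zero +_) (∑-neg (λ i → f (suc i))))
    (trans (⁻¹-∙-comm (f zero) _) (cong -_ (sym (∑-suc f)))))

  ∑-comm : ∀ {k l} (f : Fin k → Fin l → Carrier) → ∑ (λ i → ∑ (λ j → f i j)) ≡ ∑ (λ j → ∑ (λ i → f i j))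
  ∑-comm {zero}  {l} f = sym (∑-zero {l} (λ j → ∑ (λ i → f i j)) (λ j → refl))
  ∑-comm {suc k} {l} f = trans (∑-suc (λ i → ∑ (λ j → f i j)))
    (trans (cong (∑ (f zero) +_) (∑-comm (λ i → f (suc i))))
    (trans (sym (∑-+ (f zero) (λ j → ∑ (λ i → f (suc i) j)))) (∑-cong (λ j → sym (∑-suc (λ i → f i j))))))

  ∑-*- : ∀ {k} (X A B : Fin k → Carrier) (c : Carrier) →
         ∑ (λ i → X i * (A i - B i * c)) ≡ ∑ (λ i → X i * A i) - ∑ (λ i → X i * B i) * c
  ∑-*- X A B c = begin
    ∑ (λ i → X i * (A i - B i * c))            ≡⟨ ∑-cong (λ i → expand (X i) (A i) (B i) c) ⟩
    ∑ (λ i → X i * A i + - (X i * B i * c))    ≡⟨ ∑-+ (λ i → X i * A i) (λ i → - (X i * B i * c)) ⟩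
    ∑ (λ i → X i * A i) + ∑ (λ i → - (X i * B i * c))
      ≡⟨ cong (∑ (λ i → X i * A i) +_) (trans (∑-neg (λ i → X i * B i * c)) (cong -_ (∑-*ʳ c (λ i → X i * B i)))) ⟩
    ∑ (λ i → X i * A i) - ∑ (λ i → X i * B i) * c ∎
    where
      open ≡-Reasoning
      expand : ∀ x a b c → x * (a - b * c) ≡ x * a + - (x * b * c)
      expand = solve 4 (λ x a b c → x :* (a :- b :* c) := x :* a :+ (:- (x :* b :* c))) refl

  δ : ∀ {k} → Fin k → Carrier → Fin k → Carrier
  δ p c e = if does (e Fin.≟ p) then c else 0#

  δ-self : ∀ {k} (p : Fin k) c → δ p c p ≡ c
  δ-self p c with p Fin.≟ p
  ... | yes _  = refl
  ... | no p≢p = ⊥-elim (p≢p refl)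

  δ-other : ∀ {k} (p e : Fin k) c → e ≢ p → δ p c e ≡ 0#
  δ-other p e c e≢p with e Fin.≟ p
  ... | yes e≡p = ⊥-elim (e≢p e≡p)
  ... | no _    = refl

  ∑-*δ : ∀ {k} (g : Fin k → Carrier) (p : Fin k) (c : Carrier) → ∑ (λ e → g e * δ p c e) ≡ g p * c
  ∑-*δ {suc k} g zero c = trans (∑-suc (λ e → g e * δ zero c e))
    (trans (cong (g zero * c +_) (∑-zero _ (λ i → zeroʳ (g (suc i))))) (+-identityʳ _))
  ∑-*δ {suc k} g (suc p) c = trans (∑-suc (λ e → g e * δ (suc p) c e))
    (trans (cong₂ _+_ (zeroʳ (g zero)) (∑-*δ (λ i → g (suc i)) p c)) (+-identityˡ _))

  ∑-+δ-* : ∀ {k} (c : Fin k → Carrier) (p : Fin k) (d : Carrier) (g : Fin k → Carrier) →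
           ∑ (λ f → (c f + δ p d f) * g f) ≡ ∑ (λ f → c f * g f) + g p * d
  ∑-+δ-* c p d g = begin
    ∑ (λ f → (c f + δ p d f) * g f)                 ≡⟨ ∑-cong (λ f → distribʳ (g f) (c f) (δ p d f)) ⟩
    ∑ (λ f → c f * g f + δ p d f * g f)             ≡⟨ ∑-+ (λ f → c f * g f) (λ f → δ p d f * g f) ⟩
    ∑ (λ f → c f * g f) + ∑ (λ f → δ p d f * g f)
      ≡⟨ cong (∑ (λ f → c f * g f) +_) (trans (∑-cong (λ f → *-comm (δ p d f) (g f))) (∑-*δ g p d)) ⟩
    ∑ (λ f → c f * g f) + g p * d ∎
    where open ≡-Reasoning

  module _ {r ι : Carrier} (rι≡1 : r * ι ≡ 1#) where

    *+≡0⇒≡-*⁻¹ : ∀ a t → a * r + t ≡ 0# → a ≡ - t * ι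
    *+≡0⇒≡-*⁻¹ a t ar+t≡0 = begin
      a              ≡⟨ sym (trans (cong (a *_) rι≡1) (*-identityʳ a)) ⟩
      a * (r * ι)    ≡⟨ sym (*-assoc a r ι) ⟩
      a * r * ι      ≡⟨ cong (_* ι) (inverseˡ-unique (a * r) t ar+t≡0) ⟩
      - t * ι ∎
      where open ≡-Reasoning

    ≡-*⁻¹⇒*+≡0 : ∀ a t → a ≡ - t * ι → a * r + t ≡ 0#
    ≡-*⁻¹⇒*+≡0 a t a≡-tι = begin
      a * r + t              ≡⟨ cong (λ u → u * r + t) a≡-tι ⟩
      - t * ι * r + t        ≡⟨ solve 3 (λ t r i → :- t :* i :* r :+ t := t :- t :* (r :* i)) refl t r ι ⟩
      t - t * (r * ι)        ≡⟨ cong (λ u → t - t * u) rι≡1 ⟩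
      t - t * 1#             ≡⟨ cong (_-_ t) (*-identityʳ t) ⟩
      t - t                  ≡⟨ -‿inverseʳ t ⟩
      0# ∎
      where open ≡-Reasoning

  ≢0×*≡0⇒≡0 : ∀ {x y} → x ≢ 0# → x * y ≡ 0# → y ≡ 0#
  ≢0×*≡0⇒≡0 {x} {y} x≢0 xy≡0 with inverse x x≢0
  ... | x⁻¹ , xx⁻¹≡1 = begin
    y               ≡⟨ sym (*-identityˡ y) ⟩
    1# * y          ≡⟨ cong (_* y) (sym xx⁻¹≡1) ⟩
    (x * x⁻¹) * y   ≡⟨ solve 3 (λ x i y → (x :* i) :* y := i :* (x :* y)) refl x x⁻¹ y ⟩
    x⁻¹ * (x * y)   ≡⟨ cong (x⁻¹ *_) xy≡0 ⟩
    x⁻¹ * 0#        ≡⟨ zeroʳ x⁻¹ ⟩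
    0# ∎
    where open ≡-Reasoning

  ^≡0⇒≡0 : ∀ x j → x ^ j ≡ 0# → x ≡ 0#
  ^≡0⇒≡0 x j xʲ≡0 with x ≟ 0#
  ... | yes x≡0 = x≡0
  ... | no  x≢0 = ⊥-elim (^≢0 j xʲ≡0)
    where
      ^≢0 : ∀ j → x ^ j ≢ 0#
      ^≢0 zero    eq = 0≢1 (sym eq)
      ^≢0 (suc j) eq = ^≢0 j (≢0×*≡0⇒≡0 x≢0 eq)

  private
    module Enum = Inverse enum

  ∈-elements : ∀ x → x ∈ elements
  ∈-elements x = subst (_∈ elements) (Enum.strictlyInverseʳ x) (∈-map⁺ Enum.from (∈-allFin (Enum.to x)))

  length-elements : length elements ≡ size
  length-elements = trans (Listₚ.length-map Enum.from (allFin size)) (Listₚ.length-tabulate (λ i → i))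

  qℤ : ℤ
  qℤ = pos size

  sumℤ-elements-const : ∀ (c : ℤ) → sumℤ elements (λ _ → c) ≡ qℤ ℤ.* c
  sumℤ-elements-const c = trans (sumℤ-const elements c) (cong (λ k → pos k ℤ.* c) length-elements)

  sumℤ-elements-𝟙≡ : ∀ w → sumℤ elements (λ a → 𝟙 (a ≟ w)) ≡ 1ℤ
  sumℤ-elements-𝟙≡ w = trans (sumℤ-map Enum.from (allFin size) (λ a → 𝟙 (a ≟ w)))
    (trans (sumℤ-cong (allFin size) (λ i → 𝟙-⇔
       (λ eq → trans (sym (Enum.strictlyInverseˡ i)) (cong Enum.to eq))
       (λ eq → trans (cong Enum.from eq) (Enum.strictlyInverseʳ w))
       (Enum.from i ≟ w) (i Fin.≟ Enum.to w)))
     (sumℤ-allFin-𝟙≡ (Enum.to w)))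
    where
      sumℤ-allFin-suc : ∀ {k} (f : Fin (suc k) → ℤ) → sumℤ (allFin (suc k)) f ≡ f zero ℤ.+ sumℤ (allFin k) (λ i → f (suc i))
      sumℤ-allFin-suc {k} f = cong (ℤ._+_ (f zero))
        (trans (cong (λ xs → sumℤ xs f) (sym (Listₚ.map-tabulate (λ i → i) suc))) (sumℤ-map suc (allFin k) f))
      sumℤ-allFin-𝟙≡ : ∀ {k} (t : Fin k) → sumℤ (allFin k) (λ i → 𝟙 (i Fin.≟ t)) ≡ 1ℤ
      sumℤ-allFin-𝟙≡ {suc k} zero = trans (sumℤ-allFin-suc {k} (λ i → 𝟙 (i Fin.≟ zero)))
        (cong (ℤ._+_ 1ℤ) (sumℤ-zero (allFin k) (λ i → 𝟙 (suc i Fin.≟ zero)) (λ i → refl)))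
      sumℤ-allFin-𝟙≡ {suc k} (suc t) = trans (sumℤ-allFin-suc {k} (λ i → 𝟙 (i Fin.≟ suc t)))
        (trans (ℤₚ.+-identityˡ _) (sumℤ-allFin-𝟙≡ t))

  sumℤ-elements-𝟙* : ∀ w (f : Carrier → ℤ) → sumℤ elements (λ a → 𝟙 (a ≟ w) ℤ.* f a) ≡ f w
  sumℤ-elements-𝟙* w f = trans (sumℤ-cong elements (λ a → 𝟙*-cong (a ≟ w) (cong f)))
    (trans (sumℤ-*ʳ elements (f w) (λ a → 𝟙 (a ≟ w)))
     (trans (cong (ℤ._* f w) (sumℤ-elements-𝟙≡ w)) (ℤₚ.*-identityˡ (f w))))

  length-nonzeroElements : pos (length nonzeroElements) ≡ qℤ ℤ.- 1ℤ
  length-nonzeroElements = begin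
    pos (length nonzeroElements)                   ≡⟨ length-filter≡sumℤ-𝟙 (λ x → ¬? (x ≟ 0#)) elements ⟩
    sumℤ elements (λ x → 𝟙 (¬? (x ≟ 0#)))          ≡⟨ sumℤ-cong elements (λ x → 𝟙-¬ (x ≟ 0#)) ⟩
    sumℤ elements (λ x → 1ℤ ℤ.- 𝟙 (x ≟ 0#))        ≡⟨ sumℤ-- elements _ _ ⟩
    sumℤ elements (λ _ → 1ℤ) ℤ.- sumℤ elements (λ x → 𝟙 (x ≟ 0#))
      ≡⟨ cong₂ ℤ._-_ (trans (sumℤ-elements-const 1ℤ) (ℤₚ.*-identityʳ qℤ)) (sumℤ-elements-𝟙≡ 0#) ⟩
    qℤ ℤ.- 1ℤ ∎
    where open ≡-Reasoning

module SolutionCount (F : FiniteField) where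

  open FieldLemmas F
  open ≡-Reasoning

  solutionCount : ∀ m → (Fin m → Carrier) → Carrier → ℤ
  solutionCount m z b = sumℤ (vecsOver nonzeroElements m) (λ α → 𝟙 (∑ (λ e → α e * z e) ≟ b))

  zeroPattern : ∀ {m} → (Fin m → Carrier) → SubsetE m
  zeroPattern z e = does (z e ≟ 0#)

  -- baseCount p counts the α with α · z = b, for any b ≠ 0 and any z with zero pattern p.
  excess : ∀ {m} → SubsetE m → ℤ
  excess {zero}  p = 1ℤ
  excess {suc m} p = (if p zero then qℤ ℤ.- 1ℤ else ℤ.- 1ℤ) ℤ.* excess (λ e → p (suc e))

  baseCount : ∀ {m} → SubsetE m → ℤ
  baseCount {zero}  p = 0ℤ
  baseCount {suc m} p = (qℤ ℤ.- 1ℤ) ℤ.* baseCount (λ e → p (suc e)) ℤ.+ (if p zero then 0ℤ else excess (λ e → p (suc e)))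

  excess-cong : ∀ {m} {p p′ : SubsetE m} → (∀ e → p e ≡ p′ e) → excess p ≡ excess p′
  excess-cong {zero}  eq = refl
  excess-cong {suc m} eq =
    cong₂ (λ b d → (if b then qℤ ℤ.- 1ℤ else ℤ.- 1ℤ) ℤ.* d) (eq zero) (excess-cong (λ e → eq (suc e)))

  baseCount-cong : ∀ {m} {p p′ : SubsetE m} → (∀ e → p e ≡ p′ e) → baseCount p ≡ baseCount p′
  baseCount-cong {zero}  eq = refl
  baseCount-cong {suc m} eq = cong₂ ℤ._+_ (cong (ℤ._*_ (qℤ ℤ.- 1ℤ)) (baseCount-cong (λ e → eq (suc e))))
    (cong₂ (λ b d → if b then 0ℤ else d) (eq zero) (excess-cong (λ e → eq (suc e))))

  rootCount : Carrier → Carrier → ℤ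
  rootCount b z = sumℤ nonzeroElements (λ a → 𝟙 ((b - a * z) ≟ 0#))

  rootCount-zero : ∀ b z → z ≡ 0# → rootCount b z ≡ (qℤ ℤ.- 1ℤ) ℤ.* 𝟙 (b ≟ 0#)
  rootCount-zero b z z≡0 = begin
    rootCount b z                                ≡⟨ sumℤ-cong nonzeroElements (λ a → 𝟙-⇔ (trans (sym (b-az≡b a))) (trans (b-az≡b a)) ((b - a * z) ≟ 0#) (b ≟ 0#)) ⟩
    sumℤ nonzeroElements (λ _ → 𝟙 (b ≟ 0#))      ≡⟨ sumℤ-const nonzeroElements (𝟙 (b ≟ 0#)) ⟩
    pos (length nonzeroElements) ℤ.* 𝟙 (b ≟ 0#)  ≡⟨ cong (ℤ._* 𝟙 (b ≟ 0#)) length-nonzeroElements ⟩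
    (qℤ ℤ.- 1ℤ) ℤ.* 𝟙 (b ≟ 0#) ∎
    where
      b-az≡b : ∀ a → b - a * z ≡ b
      b-az≡b a = trans (cong (λ t → b - a * t) z≡0) (solve 2 (λ a b → b :- a :* con 0ℤ := b) refl a b)

  -- For z ≠ 0 the equation b − a z = 0 has the single root a = b z⁻¹, which is nonzero iff b is.
  rootCount-nonzero : ∀ b z → z ≢ 0# → rootCount b z ≡ 1ℤ ℤ.- 𝟙 (b ≟ 0#)
  rootCount-nonzero b z z≢0 with inverse z z≢0
  ... | z⁻¹ , zz⁻¹≡1 = begin
    rootCount b z                                           ≡⟨ sumℤ-cong nonzeroElements (λ a → 𝟙-⇔ (root a) (root⁻¹ a) ((b - a * z) ≟ 0#) (a ≟ w)) ⟩
    sumℤ nonzeroElements (λ a → 𝟙 (a ≟ w))                  ≡⟨ sumℤ-filter (λ x → ¬? (x ≟ 0#)) elements (λ a → 𝟙 (a ≟ w)) ⟩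
    sumℤ elements (λ a → 𝟙 (¬? (a ≟ 0#)) ℤ.* 𝟙 (a ≟ w))    ≡⟨ sumℤ-cong elements (λ a → ℤₚ.*-comm (𝟙 (¬? (a ≟ 0#))) _) ⟩
    sumℤ elements (λ a → 𝟙 (a ≟ w) ℤ.* 𝟙 (¬? (a ≟ 0#)))    ≡⟨ sumℤ-elements-𝟙* w (λ a → 𝟙 (¬? (a ≟ 0#))) ⟩
    𝟙 (¬? (w ≟ 0#))                                         ≡⟨ 𝟙-¬ (w ≟ 0#) ⟩
    1ℤ ℤ.- 𝟙 (w ≟ 0#)                                       ≡⟨ cong (ℤ._-_ 1ℤ) (𝟙-⇔ w≡0⇒b≡0 (λ b≡0 → trans (cong (_* z⁻¹) b≡0) (zeroˡ z⁻¹)) (w ≟ 0#) (b ≟ 0#)) ⟩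
    1ℤ ℤ.- 𝟙 (b ≟ 0#) ∎
    where
      w = b * z⁻¹
      cancel : ∀ c → c * z * z⁻¹ ≡ c
      cancel c = trans (*-assoc c z z⁻¹) (trans (cong (c *_) zz⁻¹≡1) (*-identityʳ c))
      root : ∀ a → b - a * z ≡ 0# → a ≡ w
      root a eq = begin
        a                      ≡⟨ sym (cancel a) ⟩
        a * z * z⁻¹            ≡⟨ cong (_* z⁻¹) (solve 3 (λ a b z → a :* z := b :- (b :- a :* z)) refl a b z) ⟩
        (b - (b - a * z)) * z⁻¹ ≡⟨ cong (λ t → (b - t) * z⁻¹) eq ⟩
        (b - 0#) * z⁻¹         ≡⟨ cong (_* z⁻¹) (solve 1 (λ b → b :- con 0ℤ := b) refl b) ⟩
        w ∎
      root⁻¹ : ∀ a → a ≡ w → b - a * z ≡ 0#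
      root⁻¹ a a≡w = begin
        b - a * z              ≡⟨ cong (λ t → b - t * z) a≡w ⟩
        b - b * z⁻¹ * z        ≡⟨ cong (_-_ b) (solve 3 (λ b i z → b :* i :* z := b :* z :* i) refl b z⁻¹ z) ⟩
        b - b * z * z⁻¹        ≡⟨ cong (_-_ b) (cancel b) ⟩
        b - b                  ≡⟨ -‿inverseʳ b ⟩
        0# ∎
      w≡0⇒b≡0 : w ≡ 0# → b ≡ 0#
      w≡0⇒b≡0 w≡0 = begin
        b                      ≡⟨ sym (cancel b) ⟩
        b * z * z⁻¹            ≡⟨ solve 3 (λ b z i → b :* z :* i := b :* i :* z) refl b z z⁻¹ ⟩
        w * z                  ≡⟨ cong (_* z) w≡0 ⟩
        0# * z                 ≡⟨ zeroˡ z ⟩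
        0# ∎

  solutionCount-suc : ∀ m (z : Fin (suc m) → Carrier) b →
                      solutionCount (suc m) z b ≡ sumℤ nonzeroElements (λ a → solutionCount m (λ e → z (suc e)) (b - a * z zero))
  solutionCount-suc m z b = trans (sumℤ-vecsOver nonzeroElements m _)
    (sumℤ-cong nonzeroElements (λ a → sumℤ-cong (vecsOver nonzeroElements m) (λ v →
      𝟙-⇔ (λ eq → moveˡ a (z zero) _ b (trans (sym (∑-suc (λ e → (a ∷ᶠ v) e * z e))) eq))
          (λ eq → trans (∑-suc (λ e → (a ∷ᶠ v) e * z e)) (moveʳ a (z zero) _ b eq))
          (∑ (λ e → (a ∷ᶠ v) e * z e) ≟ b) (∑ (λ e → v e * z (suc e)) ≟ (b - a * z zero)))))
    where
      moveˡ : ∀ a z s b → a * z + s ≡ b → s ≡ b - a * z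
      moveˡ a z s b eq = trans (solve 3 (λ a z s → s := (a :* z :+ s) :- a :* z) refl a z s) (cong (_- a * z) eq)
      moveʳ : ∀ a z s b → s ≡ b - a * z → a * z + s ≡ b
      moveʳ a z s b eq = trans (cong (a * z +_) eq) (solve 3 (λ a z b → a :* z :+ (b :- a :* z) := b) refl a z b)

  solutionCount≡ : ∀ m (z : Fin m → Carrier) b →
                   solutionCount m z b ≡ baseCount (zeroPattern z) ℤ.+ 𝟙 (b ≟ 0#) ℤ.* excess (zeroPattern z)
  solutionCount≡ zero z b = trans (ℤₚ.+-identityʳ _) (trans (𝟙-⇔ sym sym (0# ≟ b) (b ≟ 0#))
    (sym (trans (ℤₚ.+-identityˡ _) (ℤₚ.*-identityʳ _))))
  solutionCount≡ (suc m) z b = begin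
    solutionCount (suc m) z b                         ≡⟨ solutionCount-suc m z b ⟩
    sumℤ nonzeroElements (λ a → solutionCount m z′ (b - a * z zero))
      ≡⟨ sumℤ-cong nonzeroElements (λ a → solutionCount≡ m z′ (b - a * z zero)) ⟩
    sumℤ nonzeroElements (λ a → A ℤ.+ 𝟙 ((b - a * z zero) ≟ 0#) ℤ.* D)
      ≡⟨ sumℤ-+ nonzeroElements (λ _ → A) (λ a → 𝟙 ((b - a * z zero) ≟ 0#) ℤ.* D) ⟩
    sumℤ nonzeroElements (λ _ → A) ℤ.+ sumℤ nonzeroElements (λ a → 𝟙 ((b - a * z zero) ≟ 0#) ℤ.* D)
      ≡⟨ cong₂ ℤ._+_ (trans (sumℤ-const nonzeroElements A) (cong (ℤ._* A) length-nonzeroElements))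
                     (sumℤ-*ʳ nonzeroElements D (λ a → 𝟙 ((b - a * z zero) ≟ 0#))) ⟩
    (qℤ ℤ.- 1ℤ) ℤ.* A ℤ.+ rootCount b (z zero) ℤ.* D  ≡⟨ byCases (z zero ≟ 0#) ⟩
    baseCount (zeroPattern z) ℤ.+ 𝟙 (b ≟ 0#) ℤ.* excess (zeroPattern z) ∎
    where
      z′ = λ e → z (suc e)
      A = baseCount (zeroPattern z′)
      D = excess (zeroPattern z′)
      byCases : (d : Dec (z zero ≡ 0#)) →
                (qℤ ℤ.- 1ℤ) ℤ.* A ℤ.+ rootCount b (z zero) ℤ.* D
                ≡ ((qℤ ℤ.- 1ℤ) ℤ.* A ℤ.+ (if does d then 0ℤ else D))
                  ℤ.+ 𝟙 (b ≟ 0#) ℤ.* ((if does d then qℤ ℤ.- 1ℤ else ℤ.- 1ℤ) ℤ.* D)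
      byCases (yes z₀≡0) = trans (cong (λ r → (qℤ ℤ.- 1ℤ) ℤ.* A ℤ.+ r ℤ.* D) (rootCount-zero b (z zero) z₀≡0))
                                 (ring (qℤ ℤ.- 1ℤ) A D (𝟙 (b ≟ 0#)))
        where
          ring : ∀ p A D i → p ℤ.* A ℤ.+ (p ℤ.* i) ℤ.* D ≡ (p ℤ.* A ℤ.+ 0ℤ) ℤ.+ i ℤ.* (p ℤ.* D)
          ring = solve-∀
      byCases (no z₀≢0)  = trans (cong (λ r → (qℤ ℤ.- 1ℤ) ℤ.* A ℤ.+ r ℤ.* D) (rootCount-nonzero b (z zero) z₀≢0))
                                 (ring (qℤ ℤ.- 1ℤ) A D (𝟙 (b ≟ 0#)))
        where
          ring : ∀ p A D i → p ℤ.* A ℤ.+ (1ℤ ℤ.- i) ℤ.* D ≡ (p ℤ.* A ℤ.+ D) ℤ.+ i ℤ.* (ℤ.- 1ℤ ℤ.* D)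
          ring = solve-∀

module VanishingCount (F : FiniteField) where

  open FieldLemmas F
  open ≡-Reasoning

  𝟙-vanishesOn : ∀ {m} → SubsetE m → (Fin m → Carrier) → ℤ
  𝟙-vanishesOn {zero}  S y = 1ℤ
  𝟙-vanishesOn {suc m} S y = (if S zero then 𝟙 (y zero ≟ 0#) else 1ℤ) ℤ.* 𝟙-vanishesOn (λ e → S (suc e)) (λ e → y (suc e))

  vanishingCount : ∀ {n m} → Matrix F n m → SubsetE m → ℤ
  vanishingCount {n} M S = sumℤ (vecsOver elements n) (λ x → 𝟙-vanishesOn S (rowTimes F x M))

  Dependent : ∀ {n m} → Matrix F n m → SubsetE m → Set
  Dependent {n} {m} M S = Σ (Fin m → Carrier) λ c → (∀ e → S e ≡ false → c e ≡ 0#)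
    × (∀ v → ∑ (λ e → c e * M v e) ≡ 0#) × Σ (Fin m) (λ e → c e ≢ 0#)

  𝟙-vanishesOn-cong : ∀ {m} (S : SubsetE m) y y′ → (∀ e → S e ≡ true → y e ≡ y′ e) →
                      𝟙-vanishesOn S y ≡ 𝟙-vanishesOn S y′
  𝟙-vanishesOn-cong {zero}  S y y′ eq = refl
  𝟙-vanishesOn-cong {suc m} S y y′ eq = cong₂ ℤ._*_ (head≡ (S zero) refl) (𝟙-vanishesOn-cong _ _ _ (λ e → eq (suc e)))
    where
      head≡ : ∀ b → S zero ≡ b → (if b then 𝟙 (y zero ≟ 0#) else 1ℤ) ≡ (if b then 𝟙 (y′ zero ≟ 0#) else 1ℤ)
      head≡ true  S₀ = cong (λ t → 𝟙 (t ≟ 0#)) (eq zero S₀)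
      head≡ false _  = refl

  𝟙-vanishesOn-one : ∀ {m} (S : SubsetE m) y → (∀ e → S e ≡ true → y e ≡ 0#) → 𝟙-vanishesOn S y ≡ 1ℤ
  𝟙-vanishesOn-one {zero}  S y h = refl
  𝟙-vanishesOn-one {suc m} S y h = cong₂ ℤ._*_ (head≡1 (S zero) refl) (𝟙-vanishesOn-one _ _ (λ e → h (suc e)))
    where
      head≡1 : ∀ b → S zero ≡ b → (if b then 𝟙 (y zero ≟ 0#) else 1ℤ) ≡ 1ℤ
      head≡1 true  S₀ = 𝟙-yes (y zero ≟ 0#) (h zero S₀)
      head≡1 false _  = refl

  𝟙-vanishesOn-zero : ∀ {m} (S : SubsetE m) y e → S e ≡ true → y e ≢ 0# → 𝟙-vanishesOn S y ≡ 0ℤ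
  𝟙-vanishesOn-zero {suc m} S y zero S₀ y₀≢0 =
    trans (cong (λ b → (if b then 𝟙 (y zero ≟ 0#) else 1ℤ) ℤ.* 𝟙-vanishesOn (λ e → S (suc e)) (λ e → y (suc e))) S₀)
          (cong (ℤ._* 𝟙-vanishesOn (λ e → S (suc e)) (λ e → y (suc e))) (𝟙-no (y zero ≟ 0#) y₀≢0))
  𝟙-vanishesOn-zero {suc m} S y (suc e) Se ye≢0 =
    trans (cong (ℤ._*_ (if S zero then 𝟙 (y zero ≟ 0#) else 1ℤ)) (𝟙-vanishesOn-zero (λ e → S (suc e)) (λ e → y (suc e)) e Se ye≢0))
          (ℤₚ.*-zeroʳ (if S zero then 𝟙 (y zero ≟ 0#) else 1ℤ))

  𝟙-vanishesOn-∖｛｝ : ∀ {m} (p : Fin m) (S : SubsetE m) y → S p ≡ true →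
                      𝟙-vanishesOn S y ≡ 𝟙 (y p ≟ 0#) ℤ.* 𝟙-vanishesOn (S ∖｛ p ｝) y
  𝟙-vanishesOn-∖｛｝ {suc m} zero S y Sp =
    trans (cong (λ b → (if b then 𝟙 (y zero ≟ 0#) else 1ℤ) ℤ.* 𝟙-vanishesOn (λ e → S (suc e)) (λ e → y (suc e))) Sp)
          (cong (ℤ._*_ (𝟙 (y zero ≟ 0#))) (sym (ℤₚ.*-identityˡ _)))
  𝟙-vanishesOn-∖｛｝ {suc m} (suc p) S y Sp =
    trans (cong (ℤ._*_ head) (𝟙-vanishesOn-∖｛｝ p (λ e → S (suc e)) (λ e → y (suc e)) Sp))
          (x∙yz≈y∙xz head (𝟙 (y (suc p) ≟ 0#)) _)
    where
      open import Algebra.Properties.CommutativeSemigroup ℤₚ.*-commutativeSemigroup using (x∙yz≈y∙xz)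
      head = if S zero then 𝟙 (y zero ≟ 0#) else 1ℤ

  rowTimes-suc : ∀ {n m} (M : Matrix F (suc n) m) (a : Carrier) (x : Fin n → Carrier) e →
                 rowTimes F (a ∷ᶠ x) M e ≡ a * M zero e + rowTimes F x (λ v → M (suc v)) e
  rowTimes-suc M a x e = ∑-suc (λ v → (a ∷ᶠ x) v * M v e)

  tailRows : ∀ {n m} → Matrix F (suc n) m → Matrix F n m
  tailRows M v = M (suc v)

  Dependent-tailRows : ∀ {n m} (M : Matrix F (suc n) m) S → (∀ e → S e ≡ true → M zero e ≡ 0#) →
                       Dependent (tailRows M) S → Dependent M S
  Dependent-tailRows M S row₀≡0 (c , supp , Mc≡0 , nz) = c , supp , rows , nz
    where
      term≡0 : ∀ e → c e * M zero e ≡ 0#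
      term≡0 e with S e in Se
      ... | true  = trans (cong (c e *_) (row₀≡0 e Se)) (zeroʳ (c e))
      ... | false = trans (cong (_* M zero e) (supp e Se)) (zeroˡ (M zero e))
      rows : ∀ v → ∑ (λ e → c e * M v e) ≡ 0#
      rows zero    = ∑-zero (λ e → c e * M zero e) term≡0
      rows (suc v) = Mc≡0 v

  vanishingCount-tailRows : ∀ {n m} (M : Matrix F (suc n) m) S → (∀ e → S e ≡ true → M zero e ≡ 0#) →
                            vanishingCount M S ≡ qℤ ℤ.* vanishingCount (tailRows M) S
  vanishingCount-tailRows {n} M S row₀≡0 = begin
    vanishingCount M S
      ≡⟨ sumℤ-vecsOver elements n (λ x → 𝟙-vanishesOn S (rowTimes F x M)) ⟩
    sumℤ elements (λ a → sumℤ (vecsOver elements n) (λ x → 𝟙-vanishesOn S (rowTimes F (a ∷ᶠ x) M)))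
      ≡⟨ sumℤ-cong elements (λ a → sumℤ-cong (vecsOver elements n) (λ x →
           𝟙-vanishesOn-cong S _ _ (λ e Se → trans (rowTimes-suc M a x e) (first-row-drops a x e Se)))) ⟩
    sumℤ elements (λ _ → vanishingCount (tailRows M) S) ≡⟨ sumℤ-elements-const _ ⟩
    qℤ ℤ.* vanishingCount (tailRows M) S ∎
    where
      first-row-drops : ∀ a x e → S e ≡ true → a * M zero e + rowTimes F x (tailRows M) e ≡ rowTimes F x (tailRows M) e
      first-row-drops a x e Se = trans (cong (λ u → a * u + rowTimes F x (tailRows M) e) (row₀≡0 e Se))
                                       (trans (cong (_+ rowTimes F x (tailRows M) e) (zeroʳ a)) (+-identityˡ _))

  -- Clearing column p with the pivot M₀ₚ (ι = M₀ₚ⁻¹), then dropping row 0.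
  eliminate : ∀ {n m} → Matrix F (suc n) m → Fin m → Carrier → Matrix F n m
  eliminate M p ι v e = M (suc v) e - M (suc v) p * (M zero e * ι)

  module _ {n m} (M : Matrix F (suc n) m) (S : SubsetE m) (p : Fin m) (Sp : S p ≡ true)
           (ι : Carrier) (pivot : M zero p * ι ≡ 1#) where

    private
      r₀ : Fin m → Carrier
      r₀ = M zero
      M′ = tailRows M
      M″ = eliminate M p ι
      S′ = S ∖｛ p ｝

    Dependent-eliminate : Dependent M″ S′ → Dependent M S
    Dependent-eliminate (c″ , supp , M″c≡0 , e′ , c″e′≢0) = c , supp′ , rows , e′ , ce′≢0
      where
        s₀ = ∑ (λ f → c″ f * r₀ f)
        cp = - s₀ * ι
        c : Fin m → Carrier
        c f = c″ f + δ p cp f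
        c″p≡0 : c″ p ≡ 0#
        c″p≡0 = supp p (∖｛｝-self p S)
        supp′ : ∀ f → S f ≡ false → c f ≡ 0#
        supp′ f Sf = trans (cong₂ _+_ (supp f (∖｛｝-false p S f Sf))
                               (δ-other p f cp (λ f≡p → Boolₚ.not-¬ refl (trans (sym Sp) (trans (cong S (sym f≡p)) Sf)))))
                           (+-identityˡ 0#)
        ce′≢0 : c e′ ≢ 0#
        ce′≢0 = subst (_≢ 0#) (sym (trans (cong (c″ e′ +_) (δ-other p e′ cp (λ e′≡p → c″e′≢0 (trans (cong c″ e′≡p) c″p≡0))))
                                          (+-identityʳ _))) c″e′≢0
        rows : ∀ v → ∑ (λ e → c e * M v e) ≡ 0#
        rows zero = begin
          ∑ (λ f → c f * r₀ f)          ≡⟨ ∑-+δ-* c″ p cp r₀ ⟩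
          s₀ + r₀ p * (- s₀ * ι)        ≡⟨ solve 3 (λ s r i → s :+ r :* (:- s :* i) := s :- s :* (r :* i)) refl s₀ (r₀ p) ι ⟩
          s₀ - s₀ * (r₀ p * ι)          ≡⟨ cong (λ u → s₀ - s₀ * u) pivot ⟩
          s₀ - s₀ * 1#                  ≡⟨ cong (λ u → s₀ - u) (*-identityʳ s₀) ⟩
          s₀ - s₀                       ≡⟨ -‿inverseʳ s₀ ⟩
          0# ∎
        rows (suc v) = begin
          ∑ (λ f → c f * M′ v f)                     ≡⟨ ∑-+δ-* c″ p cp (M′ v) ⟩
          ∑ (λ f → c″ f * M′ v f) + M′ v p * cp       ≡⟨ cong (_+ M′ v p * cp) (x-y≡0⇒x≡y _ _ difference≡0) ⟩
          s₀ * (M′ v p * ι) + M′ v p * (- s₀ * ι)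
            ≡⟨ solve 3 (λ s m i → s :* (m :* i) :+ m :* (:- s :* i) := con 0ℤ) refl s₀ (M′ v p) ι ⟩
          0# ∎
          where
            difference≡0 : ∑ (λ f → c″ f * M′ v f) - s₀ * (M′ v p * ι) ≡ 0#
            difference≡0 = begin
              ∑ (λ f → c″ f * M′ v f) - s₀ * (M′ v p * ι)        ≡⟨ sym (∑-*- c″ (M′ v) r₀ (M′ v p * ι)) ⟩
              ∑ (λ f → c″ f * (M′ v f - r₀ f * (M′ v p * ι)))
                ≡⟨ ∑-cong (λ f → cong (λ u → c″ f * (M′ v f - u))
                     (solve 3 (λ r m i → r :* (m :* i) := m :* (r :* i)) refl (r₀ f) (M′ v p) ι)) ⟩
              ∑ (λ f → c″ f * M″ v f)                            ≡⟨ M″c≡0 v ⟩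
              0# ∎

    -- Given the lower rows x′, the vanishing of y = (a ∷ x′) M at p forces
    -- a = −(x′ M′)ₚ ι, and then y agrees with x′ M″.
    vanishingCount-eliminate : vanishingCount M S ≡ vanishingCount M″ S′
    vanishingCount-eliminate = begin
      vanishingCount M S
        ≡⟨ sumℤ-vecsOver elements n (λ x → 𝟙-vanishesOn S (rowTimes F x M)) ⟩
      sumℤ elements (λ a → sumℤ (vecsOver elements n) (λ x′ → 𝟙-vanishesOn S (y a x′)))
        ≡⟨ sumℤ-cong elements (λ a → sumℤ-cong (vecsOver elements n) (λ x′ →
             trans (𝟙-vanishesOn-∖｛｝ p S (y a x′) Sp)
                   (trans (𝟙*-cong (y a x′ p ≟ 0#) (λ yp≡0 → 𝟙-vanishesOn-cong S′ _ _ (λ e _ → y≡x′M″ a x′ yp≡0 e)))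
                          (cong (ℤ._* rest x′) (𝟙-⇔ (solve-a a x′) (solved-a a x′) (y a x′ p ≟ 0#) (a ≟ w x′)))))) ⟩
      sumℤ elements (λ a → sumℤ (vecsOver elements n) (λ x′ → 𝟙 (a ≟ w x′) ℤ.* rest x′))
        ≡⟨ sumℤ-comm elements (vecsOver elements n) (λ a x′ → 𝟙 (a ≟ w x′) ℤ.* rest x′) ⟩
      sumℤ (vecsOver elements n) (λ x′ → sumℤ elements (λ a → 𝟙 (a ≟ w x′) ℤ.* rest x′))
        ≡⟨ sumℤ-cong (vecsOver elements n) (λ x′ → sumℤ-elements-𝟙* (w x′) (λ _ → rest x′)) ⟩
      vanishingCount M″ S′ ∎
      where
        t : (Fin n → Carrier) → Fin m → Carrier
        t x′ = rowTimes F x′ M′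
        rest : (Fin n → Carrier) → ℤ
        rest x′ = 𝟙-vanishesOn S′ (rowTimes F x′ M″)
        y : Carrier → (Fin n → Carrier) → Fin m → Carrier
        y a x′ = rowTimes F (a ∷ᶠ x′) M
        w : (Fin n → Carrier) → Carrier
        w x′ = - t x′ p * ι
        solve-a : ∀ a x′ → y a x′ p ≡ 0# → a ≡ w x′
        solve-a a x′ yp≡0 = *+≡0⇒≡-*⁻¹ pivot a (t x′ p) (trans (sym (rowTimes-suc M a x′ p)) yp≡0)
        solved-a : ∀ a x′ → a ≡ w x′ → y a x′ p ≡ 0#
        solved-a a x′ a≡w = trans (rowTimes-suc M a x′ p) (≡-*⁻¹⇒*+≡0 pivot a (t x′ p) a≡w)
        y≡x′M″ : ∀ a x′ → y a x′ p ≡ 0# → ∀ e → y a x′ e ≡ rowTimes F x′ M″ e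
        y≡x′M″ a x′ yp≡0 e = begin
          y a x′ e                            ≡⟨ rowTimes-suc M a x′ e ⟩
          a * r₀ e + t x′ e                   ≡⟨ cong (λ u → u * r₀ e + t x′ e) (solve-a a x′ yp≡0) ⟩
          - t x′ p * ι * r₀ e + t x′ e
            ≡⟨ solve 4 (λ tp i r te → :- tp :* i :* r :+ te := te :- tp :* (r :* i)) refl (t x′ p) ι (r₀ e) (t x′ e) ⟩
          t x′ e - t x′ p * (r₀ e * ι)        ≡⟨ sym (∑-*- x′ (λ v → M′ v e) (λ v → M′ v p) (r₀ e * ι)) ⟩
          rowTimes F x′ M″ e ∎

  dependent⊎vanishingCount : ∀ n {m} (M : Matrix F n m) (S : SubsetE m) →
                             Dependent M S ⊎ vanishingCount M S ℤ.* qℤ ℤ.^ card S ≡ qℤ ℤ.^ n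
  dependent⊎vanishingCount zero M S with Finₚ.any? (λ e → S e Data.Bool.≟ true)
  ... | yes (e , Se) = inj₁ (δ e 1# , supp , (λ ()) , e , δe≢0)
    where
      supp : ∀ f → S f ≡ false → δ e 1# f ≡ 0#
      supp f Sf = δ-other e f 1# (λ f≡e → Boolₚ.not-¬ refl (trans (sym Se) (trans (cong S (sym f≡e)) Sf)))
      δe≢0 : δ e 1# e ≢ 0#
      δe≢0 eq = 0≢1 (sym (trans (sym (δ-self e 1#)) eq))
  ... | no ∄e = inj₂ (cong₂ (λ k c → k ℤ.* qℤ ℤ.^ c) (trans (ℤₚ.+-identityʳ _) (𝟙-vanishesOn-one S _ (λ e Se → ⊥-elim (∄e (e , Se)))))
                            (card-empty S (λ e → Boolₚ.¬-not (λ Se → ∄e (e , Se)))))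
  dependent⊎vanishingCount (suc n) M S with Finₚ.any? (λ e → (S e Data.Bool.≟ true) ×-dec ¬? (M zero e ≟ 0#))
  ... | no ∄pivot = from-tailRows (dependent⊎vanishingCount n (tailRows M) S)
    where
      row₀≡0 : ∀ e → S e ≡ true → M zero e ≡ 0#
      row₀≡0 e Se = decidable-stable (M zero e ≟ 0#) (λ ≢0 → ∄pivot (e , Se , ≢0))
      from-tailRows : Dependent (tailRows M) S ⊎ vanishingCount (tailRows M) S ℤ.* qℤ ℤ.^ card S ≡ qℤ ℤ.^ n →
                      Dependent M S ⊎ vanishingCount M S ℤ.* qℤ ℤ.^ card S ≡ qℤ ℤ.^ suc n
      from-tailRows (inj₁ dep) = inj₁ (Dependent-tailRows M S row₀≡0 dep)
      from-tailRows (inj₂ eq)  = inj₂ (begin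
        vanishingCount M S ℤ.* qℤ ℤ.^ card S                    ≡⟨ cong (ℤ._* qℤ ℤ.^ card S) (vanishingCount-tailRows M S row₀≡0) ⟩
        qℤ ℤ.* vanishingCount (tailRows M) S ℤ.* qℤ ℤ.^ card S   ≡⟨ ℤₚ.*-assoc qℤ _ _ ⟩
        qℤ ℤ.* (vanishingCount (tailRows M) S ℤ.* qℤ ℤ.^ card S) ≡⟨ cong (qℤ ℤ.*_) eq ⟩
        qℤ ℤ.^ suc n ∎)
  ... | yes (p , Sp , M₀p≢0) with inverse (M zero p) M₀p≢0
  ...   | ι , pivot = from-eliminate (dependent⊎vanishingCount n (eliminate M p ι) (S ∖｛ p ｝))
    where
      open import Algebra.Properties.CommutativeSemigroup ℤₚ.*-commutativeSemigroup using (x∙yz≈y∙xz)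
      S′ = S ∖｛ p ｝
      K = vanishingCount (eliminate M p ι) S′
      from-eliminate : Dependent (eliminate M p ι) S′ ⊎ K ℤ.* qℤ ℤ.^ card S′ ≡ qℤ ℤ.^ n →
                       Dependent M S ⊎ vanishingCount M S ℤ.* qℤ ℤ.^ card S ≡ qℤ ℤ.^ suc n
      from-eliminate (inj₁ dep) = inj₁ (Dependent-eliminate M S p Sp ι pivot dep)
      from-eliminate (inj₂ eq)  = inj₂ (begin
        vanishingCount M S ℤ.* qℤ ℤ.^ card S
          ≡⟨ cong₂ (λ k c → k ℤ.* qℤ ℤ.^ c) (vanishingCount-eliminate M S p Sp ι pivot) (card-∖｛｝ p S Sp) ⟩
        K ℤ.* (qℤ ℤ.* qℤ ℤ.^ card S′)  ≡⟨ x∙yz≈y∙xz K qℤ _ ⟩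
        qℤ ℤ.* (K ℤ.* qℤ ℤ.^ card S′)  ≡⟨ cong (qℤ ℤ.*_) eq ⟩
        qℤ ℤ.^ suc n ∎)

module Rank (F : FiniteField) where

  open FieldLemmas F
  open VanishingCount F
  open ≡-Reasoning

  Independent : ∀ {n m} → Matrix F n m → SubsetE m → Set
  Independent {n} {m} M B = ∀ (c : Fin m → Carrier) → (∀ e → B e ≡ false → c e ≡ 0#) →
    (∀ v → ∑ (λ e → c e * M v e) ≡ 0#) → ∀ e → c e ≡ 0#

  Dependent⇒¬Independent : ∀ {n m} (M : Matrix F n m) B → Dependent M B → ¬ Independent M B
  Dependent⇒¬Independent M B (c , supp , Mc≡0 , e , ce≢0) indep = ce≢0 (indep c supp Mc≡0 e)

  Independent-cong : ∀ {n m} (M : Matrix F n m) {B B′} → (∀ e → B e ≡ B′ e) → Independent M B → Independent M B′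
  Independent-cong M B≗B′ indep c supp = indep c (λ e Be → supp e (trans (sym (B≗B′ e)) Be))

  private
    does-sound : ∀ {P : Set} (d : Dec P) → does d ≡ true → P
    does-sound (yes p) _ = p

    does-false⇒¬ : ∀ {P : Set} (d : Dec P) → does d ≡ false → ¬ P
    does-false⇒¬ (no ¬p) _ = ¬p

  module _ {n m : ℕ} (M : Matrix F n m) where

    private
      supportedᵇ : SubsetE m → (Fin m → Carrier) → Bool
      supportedᵇ B c = all (λ e → if B e then true else does (c e ≟ 0#)) (allFin m)
      annihilatesᵇ : (Fin m → Carrier) → Bool
      annihilatesᵇ c = all (λ v → does (∑ (λ e → c e * M v e) ≟ 0#)) (allFin n)
      isZeroᵇ : (Fin m → Carrier) → Bool
      isZeroᵇ c = all (λ e → does (c e ≟ 0#)) (allFin m)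

      supportedᵇ-sound : ∀ B c → supportedᵇ B c ≡ true → ∀ e → B e ≡ false → c e ≡ 0#
      supportedᵇ-sound B c h e Be = does-sound (c e ≟ 0#)
        (subst (λ b → (if b then true else does (c e ≟ 0#)) ≡ true) Be (all-sound _ (allFin m) h (∈-allFin e)))

      supportedᵇ-complete : ∀ B c → (∀ e → B e ≡ false → c e ≡ 0#) → supportedᵇ B c ≡ true
      supportedᵇ-complete B c h = all-complete _ (allFin m) pointwise
        where
          pointwise : ∀ e → (if B e then true else does (c e ≟ 0#)) ≡ true
          pointwise e with B e in Be
          ... | true  = refl
          ... | false = dec-true (c e ≟ 0#) (h e Be)

      annihilatesᵇ-sound : ∀ c → annihilatesᵇ c ≡ true → ∀ v → ∑ (λ e → c e * M v e) ≡ 0#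
      annihilatesᵇ-sound c h v = does-sound (∑ (λ e → c e * M v e) ≟ 0#) (all-sound _ (allFin n) h (∈-allFin v))

      annihilatesᵇ-complete : ∀ c → (∀ v → ∑ (λ e → c e * M v e) ≡ 0#) → annihilatesᵇ c ≡ true
      annihilatesᵇ-complete c h = all-complete _ (allFin n) (λ v → dec-true (∑ (λ e → c e * M v e) ≟ 0#) (h v))

    independentᵇ-sound : ∀ B → independentᵇ F M B ≡ true → Independent M B
    independentᵇ-sound B h c supp Mc≡0 e with ∈-vecsOver elements m c (λ i → ∈-elements (c i))
    ... | c′ , c′∈ , c′≗c = trans (sym (c′≗c e)) (does-sound (c′ e ≟ 0#) (all-sound _ (allFin m) c′≡0 (∈-allFin e)))
      where
        c′≡0 : isZeroᵇ c′ ≡ true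
        c′≡0 = subst (λ b → (if b then isZeroᵇ c′ else true) ≡ true)
          (∧≡true⇐ (supportedᵇ-complete B c′ (λ f Bf → trans (c′≗c f) (supp f Bf)))
                   (annihilatesᵇ-complete c′ (λ v → trans (∑-cong (λ f → cong (_* M v f) (c′≗c f))) (Mc≡0 v))))
          (all-sound _ (vecsOver elements m) h c′∈)

    independentᵇ-complete : ∀ B → Independent M B → independentᵇ F M B ≡ true
    independentᵇ-complete B indep = all-complete _ (vecsOver elements m) pointwise
      where
        pointwise : ∀ c → (if supportedᵇ B c ∧ annihilatesᵇ c then isZeroᵇ c else true) ≡ true
        pointwise c with supportedᵇ B c ∧ annihilatesᵇ c in eq
        ... | false = refl
        ... | true with ∧≡true⇒ (supportedᵇ B c) (annihilatesᵇ c) eq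
        ...   | supp , ann = all-complete _ (allFin m)
                  (λ e → dec-true (c e ≟ 0#) (indep c (supportedᵇ-sound B c supp) (annihilatesᵇ-sound c ann) e))

    independentᵇ-false⇒Dependent : ∀ B → independentᵇ F M B ≡ false → Dependent M B
    independentᵇ-false⇒Dependent B h with all≡false⇒counterexample _ (vecsOver elements m) h
    ... | c , eq with supportedᵇ B c ∧ annihilatesᵇ c in cond
    ...   | true with ∧≡true⇒ (supportedᵇ B c) (annihilatesᵇ c) cond | all≡false⇒counterexample _ (allFin m) eq
    ...     | supp , ann | e , ce≟0 = c , supportedᵇ-sound B c supp , annihilatesᵇ-sound c ann , e , does-false⇒¬ (c e ≟ 0#) ce≟0

    private
      IndependentSubsetᵇ : SubsetE m → SubsetE m → Bool
      IndependentSubsetᵇ A B = (B ⊆ᵇ A) ∧ independentᵇ F M B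

      independentSubset? : (A : SubsetE m) → Decidable (λ B → T (IndependentSubsetᵇ A B))
      independentSubset? A B = T? (IndependentSubsetᵇ A B)

      open module MaxCard (A : SubsetE m) = Maximum (independentSubset? A) card

      T⇒≡true : ∀ {b} → T b → b ≡ true
      T⇒≡true = Equivalence.to Boolₚ.T-≡

      ≡true⇒T : ∀ {b} → b ≡ true → T b
      ≡true⇒T = Equivalence.from Boolₚ.T-≡

      ∈-allSubsets : (B : SubsetE m) → Σ (SubsetE m) (λ B′ → B′ ∈ allSubsets m × (∀ e → B′ e ≡ B e))
      ∈-allSubsets B = ∈-vecsOver (true ∷ false ∷ []) m B (λ e → ∈-bools (B e))
        where
          ∈-bools : ∀ b → b ∈ (true ∷ false ∷ [])
          ∈-bools true  = here refl
          ∈-bools false = there (here refl)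

    independent⇒card≤rank : ∀ A B → B ⊆ A → Independent M B → card B ≤ rank F M A
    independent⇒card≤rank A B B⊆A indep with ∈-allSubsets B
    ... | B′ , B′∈ , B′≗B = subst (_≤ rank F M A) (card-cong B′ B B′≗B)
      (≤-maxOver A (allSubsets m) B′∈ (≡true⇒T (∧≡true⇐
        (⊆ᵇ-complete B′ A (λ e B′e → B⊆A e (trans (sym (B′≗B e)) B′e)))
        (independentᵇ-complete B′ (Independent-cong M (λ e → sym (B′≗B e)) indep)))))

    record Basis (A : SubsetE m) : Set where
      field
        basis       : SubsetE m
        basis⊆A     : basis ⊆ A
        independent : Independent M basis
        card≡rank   : card basis ≡ rank F M A
        maximal     : ∀ e → A e ≡ true → basis e ≡ false → Dependent M (basis ∪｛ e ｝)

    -- The empty set witnesses that the maximum defining the rank is attained.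
    basisOf : ∀ A → Basis A
    basisOf A with ∈-allSubsets (λ _ → false)
    ... | ∅ , ∅∈ , ∅≗ with maxOver-attained A (allSubsets m) ∅∈
          (≡true⇒T (∧≡true⇐ (⊆ᵇ-complete ∅ A (λ e ∅e → ⊥-elim (Boolₚ.not-¬ refl (trans (sym ∅e) (∅≗ e)))))
                             (independentᵇ-complete ∅ (λ c supp _ e → supp e (∅≗ e)))))
    ... | I , _ , I-ok , cardI = record
      { basis       = I
      ; basis⊆A     = ⊆ᵇ-sound I A (proj₁ I-ok′)
      ; independent = independentᵇ-sound I (proj₂ I-ok′)
      ; card≡rank   = cardI
      ; maximal     = maximal
      }
      where
        I-ok′ = ∧≡true⇒ _ _ (T⇒≡true I-ok)
        maximal : ∀ e → A e ≡ true → I e ≡ false → Dependent M (I ∪｛ e ｝)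
        maximal e Ae Ie with independentᵇ F M (I ∪｛ e ｝) in indep
        ... | false = independentᵇ-false⇒Dependent (I ∪｛ e ｝) indep
        ... | true  = ⊥-elim (ℕₚ.<-irrefl refl (ℕₚ.≤-trans larger (ℕₚ.≤-reflexive (sym cardI))))
          where
            I∪e⊆A : (I ∪｛ e ｝) ⊆ A
            I∪e⊆A f h with f Fin.≟ e
            ... | yes refl = Ae
            ... | no _     = ⊆ᵇ-sound I A (proj₁ I-ok′) f h
            larger : suc (card I) ≤ rank F M A
            larger = subst (_≤ rank F M A)
              (trans (card-∖｛｝ e (I ∪｛ e ｝) (∪｛｝-self e I)) (cong suc (card-cong _ _ (∪｛｝∖｛｝ e I Ie))))
              (independent⇒card≤rank A (I ∪｛ e ｝) I∪e⊆A (independentᵇ-sound (I ∪｛ e ｝) indep))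

    rank≤card : ∀ A → rank F M A ≤ card A
    rank≤card A = subst (_≤ card A) card≡rank (card-mono _ A basis⊆A)
      where open Basis (basisOf A)

    rank-fullSet≤card+rank-complement : ∀ B → rank F M fullSet ≤ card B ℕ.+ rank F M (complement B)
    rank-fullSet≤card+rank-complement B = subst (_≤ card B ℕ.+ rank F M (complement B)) card≡rank
      (ℕₚ.≤-trans (card≤card+card∖ basis B) (ℕₚ.+-monoʳ-≤ (card B)
        (independent⇒card≤rank (complement B) I∖B (λ f h → proj₂ (∧≡true⇒ (basis f) _ h)) I∖B-independent)))
      where
        open Basis (basisOf fullSet)
        I∖B : SubsetE m
        I∖B f = basis f ∧ not (B f)
        I∖B-independent : Independent M I∖B
        I∖B-independent c supp = independent c (λ f If → supp f (cong (_∧ not (B f)) If))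

    ∑*rowTimes≡0 : ∀ (c : Fin m → Carrier) x → (∀ v → ∑ (λ f → c f * M v f) ≡ 0#) →
                   ∑ (λ f → c f * rowTimes F x M f) ≡ 0#
    ∑*rowTimes≡0 c x Mc≡0 = begin
      ∑ (λ f → c f * ∑ (λ v → x v * M v f))     ≡⟨ ∑-cong (λ f → sym (∑-*ˡ (c f) (λ v → x v * M v f))) ⟩
      ∑ (λ f → ∑ (λ v → c f * (x v * M v f)))   ≡⟨ ∑-comm (λ f v → c f * (x v * M v f)) ⟩
      ∑ (λ v → ∑ (λ f → c f * (x v * M v f)))
        ≡⟨ ∑-cong (λ v → trans (∑-cong (λ f → solve 3 (λ c x m → c :* (x :* m) := x :* (c :* m)) refl (c f) (x v) (M v f)))
                                (∑-*ˡ (x v) (λ f → c f * M v f))) ⟩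
      ∑ (λ v → x v * ∑ (λ f → c f * M v f))     ≡⟨ ∑-zero _ (λ v → trans (cong (x v *_) (Mc≡0 v)) (zeroʳ (x v))) ⟩
      0# ∎

    module _ (A : SubsetE m) where

      open Basis (basisOf A)

      -- Every column of A outside the basis is a combination of basis columns.
      vanishesOn-basis⇒vanishesOn : ∀ x → (∀ e → basis e ≡ true → rowTimes F x M e ≡ 0#) →
                                     ∀ e → A e ≡ true → rowTimes F x M e ≡ 0#
      vanishesOn-basis⇒vanishesOn x y≡0 e Ae with basis e in Ie
      ... | true  = y≡0 e Ie
      ... | false with maximal e Ae Ie
      ...   | c , supp , Mc≡0 , e′ , ce′≢0 = ≢0×*≡0⇒≡0 ce≢0 ce*ye≡0
        where
          y = rowTimes F x M
          supp-basis : ∀ f → f ≢ e → basis f ≡ false → c f ≡ 0#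
          supp-basis f f≢e If = supp f (trans (∪｛｝-other e basis f≢e) If)
          ce*ye≡0 : c e * y e ≡ 0#
          ce*ye≡0 = begin
            c e * y e                    ≡⟨ sym (*-identityʳ _) ⟩
            c e * y e * 1#               ≡⟨ sym (∑-*δ (λ f → c f * y f) e 1#) ⟩
            ∑ (λ f → c f * y f * δ e 1# f) ≡⟨ ∑-cong only-e ⟩
            ∑ (λ f → c f * y f)          ≡⟨ ∑*rowTimes≡0 c x Mc≡0 ⟩
            0# ∎
            where
              only-e : ∀ f → c f * y f * δ e 1# f ≡ c f * y f
              only-e f with f Fin.≟ e
              ... | yes _ = *-identityʳ _
              ... | no f≢e with basis f in If
              ...   | true  = trans (zeroʳ _) (sym (trans (cong (c f *_) (y≡0 f If)) (zeroʳ (c f))))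
              ...   | false = trans (zeroʳ _) (sym (trans (cong (_* y f) (supp-basis f f≢e If)) (zeroˡ (y f))))
          ce≢0 : c e ≢ 0#
          ce≢0 ce≡0 = Dependent⇒¬Independent M basis (c , supp′ , Mc≡0 , e′ , ce′≢0) independent
            where
              supp′ : ∀ f → basis f ≡ false → c f ≡ 0#
              supp′ f If with f Fin.≟ e
              ... | yes refl = ce≡0
              ... | no f≢e   = supp-basis f f≢e If

      𝟙-vanishesOn-basis : ∀ x → 𝟙-vanishesOn A (rowTimes F x M) ≡ 𝟙-vanishesOn basis (rowTimes F x M)
      𝟙-vanishesOn-basis x with Finₚ.any? (λ e → (basis e Data.Bool.≟ true) ×-dec ¬? (rowTimes F x M e ≟ 0#))
      ... | yes (e , Ie , ye≢0) =
        trans (𝟙-vanishesOn-zero A _ e (basis⊆A e Ie) ye≢0) (sym (𝟙-vanishesOn-zero basis _ e Ie ye≢0))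
      ... | no ∄e = trans (𝟙-vanishesOn-one A _ (vanishesOn-basis⇒vanishesOn x y≡0)) (sym (𝟙-vanishesOn-one basis _ y≡0))
        where
          y≡0 : ∀ e → basis e ≡ true → rowTimes F x M e ≡ 0#
          y≡0 e Ie = decidable-stable (rowTimes F x M e ≟ 0#) (λ ye≢0 → ∄e (e , Ie , ye≢0))

      vanishingCount*q^rank : vanishingCount M A ℤ.* qℤ ℤ.^ rank F M A ≡ qℤ ℤ.^ n
      vanishingCount*q^rank with dependent⊎vanishingCount n M basis
      ... | inj₁ dep = ⊥-elim (Dependent⇒¬Independent M basis dep independent)
      ... | inj₂ eq = trans (cong₂ (λ k r → k ℤ.* qℤ ℤ.^ r) (sumℤ-cong (vecsOver elements n) 𝟙-vanishesOn-basis) (sym card≡rank)) eq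

module _ {m : ℕ} (r : SubsetE m → ℕ) (r≤card : ∀ A → r A ≤ card A)
         (r-fullSet≤ : ∀ B → r fullSet ≤ card B ℕ.+ r (complement B)) where

  dualRank-fullSet∸dualRank+rank : ∀ B → (dualRank r fullSet ∸ dualRank r B) ℕ.+ r (complement B) ≡ card (complement B)
  dualRank-fullSet∸dualRank+rank B = begin
    ((card {m} fullSet ℕ.+ r (complement fullSet)) ∸ R ∸ ((b ℕ.+ r′) ∸ R)) ℕ.+ r′
      ≡⟨ cong (λ t → (t ∸ R ∸ ((b ℕ.+ r′) ∸ R)) ℕ.+ r′) card-fullSet+r∅ ⟩
    ((m ∸ R) ∸ ((b ℕ.+ r′) ∸ R)) ℕ.+ r′  ≡⟨ cong (ℕ._+ r′) (ℕₚ.∸-+-assoc m R _) ⟩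
    (m ∸ (R ℕ.+ ((b ℕ.+ r′) ∸ R))) ℕ.+ r′ ≡⟨ cong (λ t → (m ∸ t) ℕ.+ r′) (ℕₚ.m+[n∸m]≡n (r-fullSet≤ B)) ⟩
    (m ∸ (b ℕ.+ r′)) ℕ.+ r′              ≡⟨ cong (λ t → (t ∸ (b ℕ.+ r′)) ℕ.+ r′) (sym (card-complement B)) ⟩
    ((b ℕ.+ b′) ∸ (b ℕ.+ r′)) ℕ.+ r′     ≡⟨ cong (ℕ._+ r′) (ℕₚ.[m+n]∸[m+o]≡n∸o b b′ r′) ⟩
    (b′ ∸ r′) ℕ.+ r′                     ≡⟨ ℕₚ.m∸n+n≡m (r≤card (complement B)) ⟩
    b′ ∎
    where
      open ≡-Reasoning
      R = r fullSet
      b = card B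
      b′ = card (complement B)
      r′ = r (complement B)
      card-fullSet+r∅ : card {m} fullSet ℕ.+ r (complement fullSet) ≡ m
      card-fullSet+r∅ = trans (cong₂ ℕ._+_ (card-fullSet m)
        (ℕₚ.n≤0⇒n≡0 (subst (r (complement fullSet) ≤_) (card-empty {m} (complement fullSet) (λ _ → refl)) (r≤card _))))
        (ℕₚ.+-identityʳ m)

module Theorem (F : FiniteField) where

  open FieldLemmas F
  open SolutionCount F
  open VanishingCount F
  open Rank F
  open ≡-Reasoning

  subsetTerm : ∀ {m} → (Fin m → Carrier) → SubsetE m → ℤ
  subsetTerm y B = -1ℤ ℤ.^ card B ℤ.* (qℤ ℤ.^ card (complement B) ℤ.* 𝟙-vanishesOn (complement B) y)

  -- Π_e (q [y_e = 0] − 1), expanded over the subsets B of the factors taking −1.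
  excess≡sumℤ-subsetTerm : ∀ m (y : Fin m → Carrier) → excess (zeroPattern y) ≡ sumℤ (allSubsets m) (subsetTerm y)
  excess≡sumℤ-subsetTerm zero    y = refl
  excess≡sumℤ-subsetTerm (suc m) y = begin
    excess (zeroPattern y)                          ≡⟨ head-factor (y zero ≟ 0#) ⟩
    ℤ.- 1ℤ ℤ.* D ℤ.+ ((qℤ ℤ.* 𝟙₀) ℤ.* D ℤ.+ 0ℤ)
      ≡⟨ cong₂ (λ a b → a ℤ.+ (b ℤ.+ 0ℤ))
           (trans (cong (ℤ._*_ (ℤ.- 1ℤ)) (excess≡sumℤ-subsetTerm m y′))
                  (sym (trans (sumℤ-cong subsets in-B) (sumℤ-*ˡ subsets (ℤ.- 1ℤ) (subsetTerm y′)))))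
           (trans (cong (ℤ._*_ (qℤ ℤ.* 𝟙₀)) (excess≡sumℤ-subsetTerm m y′))
                  (sym (trans (sumℤ-cong subsets not-in-B) (sumℤ-*ˡ subsets (qℤ ℤ.* 𝟙₀) (subsetTerm y′))))) ⟩
    sumℤ subsets (λ B → subsetTerm y (true ∷ᶠ B)) ℤ.+ (sumℤ subsets (λ B → subsetTerm y (false ∷ᶠ B)) ℤ.+ 0ℤ)
      ≡⟨ sym (sumℤ-vecsOver (true ∷ false ∷ []) m (subsetTerm y)) ⟩
    sumℤ (allSubsets (suc m)) (subsetTerm y) ∎
    where
      y′ = λ e → y (suc e)
      subsets = allSubsets m
      D = excess (zeroPattern y′)
      𝟙₀ = 𝟙 (y zero ≟ 0#)
      head-factor : (d : Dec (y zero ≡ 0#)) →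
                    (if does d then qℤ ℤ.- 1ℤ else ℤ.- 1ℤ) ℤ.* D ≡ ℤ.- 1ℤ ℤ.* D ℤ.+ ((qℤ ℤ.* 𝟙 d) ℤ.* D ℤ.+ 0ℤ)
      head-factor (yes _) = ring qℤ D
        where
          ring : ∀ q D → (q ℤ.- 1ℤ) ℤ.* D ≡ ℤ.- 1ℤ ℤ.* D ℤ.+ ((q ℤ.* 1ℤ) ℤ.* D ℤ.+ 0ℤ)
          ring = solve-∀
      head-factor (no _)  = ring qℤ D
        where
          ring : ∀ q D → ℤ.- 1ℤ ℤ.* D ≡ ℤ.- 1ℤ ℤ.* D ℤ.+ ((q ℤ.* 0ℤ) ℤ.* D ℤ.+ 0ℤ)
          ring = solve-∀
      in-B : ∀ B → subsetTerm y (true ∷ᶠ B) ≡ ℤ.- 1ℤ ℤ.* subsetTerm y′ B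
      in-B B = trans (cong₂ (λ c d → -1ℤ ℤ.^ c ℤ.* (qℤ ℤ.^ d ℤ.* 𝟙-vanishesOn (complement (true ∷ᶠ B)) y))
                            (card-suc (true ∷ᶠ B)) (card-suc (complement (true ∷ᶠ B))))
                     (ring (-1ℤ ℤ.^ card B) (qℤ ℤ.^ card (complement B)) (𝟙-vanishesOn (complement B) y′))
        where
          ring : ∀ s Q I → (ℤ.- 1ℤ ℤ.* s) ℤ.* (Q ℤ.* (1ℤ ℤ.* I)) ≡ ℤ.- 1ℤ ℤ.* (s ℤ.* (Q ℤ.* I))
          ring = solve-∀
      not-in-B : ∀ B → subsetTerm y (false ∷ᶠ B) ≡ (qℤ ℤ.* 𝟙₀) ℤ.* subsetTerm y′ B
      not-in-B B = trans (cong₂ (λ c d → -1ℤ ℤ.^ c ℤ.* (qℤ ℤ.^ d ℤ.* 𝟙-vanishesOn (complement (false ∷ᶠ B)) y))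
                                (card-suc (false ∷ᶠ B)) (card-suc (complement (false ∷ᶠ B))))
                         (ring (-1ℤ ℤ.^ card B) qℤ (qℤ ℤ.^ card (complement B)) 𝟙₀ (𝟙-vanishesOn (complement B) y′))
        where
          ring : ∀ s q Q d I → s ℤ.* ((q ℤ.* Q) ℤ.* (d ℤ.* I)) ≡ (q ℤ.* d) ℤ.* (s ℤ.* (Q ℤ.* I))
          ring = solve-∀

  module _ {n m : ℕ} (M : Matrix F n m) where

    private
      xs = vecsOver elements n
      y : (Fin n → Carrier) → Fin m → Carrier
      y x = rowTimes F x M

    zeroPattern-^ : ∀ j → 1 ≤ j → ∀ x e → zeroPattern (λ e → y x e ^ j) e ≡ zeroPattern (y x) e
    zeroPattern-^ (suc j) _ x e = does-⇔ (mk⇔ (^≡0⇒≡0 (y x e) (suc j)) (λ ye≡0 → trans (cong (λ t → t * (t ^ j)) ye≡0) (zeroˡ _)))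
                                          ((y x e ^ suc j) ≟ 0#) (y x e ≟ 0#)

    N≡sumℤ : ∀ b j → 1 ≤ j →
         pos (N F M b j) ≡ sumℤ xs (λ x → baseCount (zeroPattern (y x)) ℤ.+ 𝟙 (b ≟ 0#) ℤ.* excess (zeroPattern (y x)))
    N≡sumℤ b j 1≤j = begin
      pos (N F M b j)                         ≡⟨ length-filter≡sumℤ-𝟙 Q≟b pairs ⟩
      sumℤ pairs (λ xα → 𝟙 (Q≟b xα))        ≡⟨ sumℤ-concatMap (λ x → map (x ,_) αs) xs (λ xα → 𝟙 (Q≟b xα)) ⟩
      sumℤ xs (λ x → sumℤ (map (x ,_) αs) (λ xα → 𝟙 (Q≟b xα)))
        ≡⟨ sumℤ-cong xs (λ x → sumℤ-map (x ,_) αs (λ xα → 𝟙 (Q≟b xα))) ⟩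
      sumℤ xs (λ x → solutionCount m (λ e → y x e ^ j) b)
        ≡⟨ sumℤ-cong xs (λ x → trans (solutionCount≡ m (λ e → y x e ^ j) b)
             (cong₂ (λ a d → a ℤ.+ 𝟙 (b ≟ 0#) ℤ.* d) (baseCount-cong (zeroPattern-^ j 1≤j x))
                                                    (excess-cong (zeroPattern-^ j 1≤j x)))) ⟩
      sumℤ xs (λ x → baseCount (zeroPattern (y x)) ℤ.+ 𝟙 (b ≟ 0#) ℤ.* excess (zeroPattern (y x))) ∎
      where
        αs = vecsOver nonzeroElements m
        pairs = concatMap (λ x → map (x ,_) αs) xs
        Q≟b = λ (xα : (Fin n → Carrier) × (Fin m → Carrier)) → uncurry (λ x α → Q F M j x α ≟ b) xα

    N-independent-of-j : ∀ b j j′ → 1 ≤ j → 1 ≤ j′ → N F M b j ≡ N F M b j′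
    N-independent-of-j b j j′ 1≤j 1≤j′ = ℤₚ.+-injective (trans (N≡sumℤ b j 1≤j) (sym (N≡sumℤ b j′ 1≤j′)))

    N₀-N₁≡sumℤ-excess : ∀ j → 1 ≤ j → pos (N F M 0# j) ℤ.- pos (N F M 1# j) ≡ sumℤ xs (λ x → excess (zeroPattern (y x)))
    N₀-N₁≡sumℤ-excess j 1≤j = begin
      pos (N F M 0# j) ℤ.- pos (N F M 1# j)
        ≡⟨ cong₂ ℤ._-_ (N≡sumℤ 0# j 1≤j) (N≡sumℤ 1# j 1≤j) ⟩
      sumℤ xs (λ x → A x ℤ.+ 𝟙 (0# ≟ 0#) ℤ.* D x) ℤ.- sumℤ xs (λ x → A x ℤ.+ 𝟙 (1# ≟ 0#) ℤ.* D x)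
        ≡⟨ sym (sumℤ-- xs _ _) ⟩
      sumℤ xs (λ x → (A x ℤ.+ 𝟙 (0# ≟ 0#) ℤ.* D x) ℤ.- (A x ℤ.+ 𝟙 (1# ≟ 0#) ℤ.* D x))
        ≡⟨ sumℤ-cong xs (λ x → trans (cong₂ (λ a b → (A x ℤ.+ a ℤ.* D x) ℤ.- (A x ℤ.+ b ℤ.* D x))
                                             (𝟙-yes (0# ≟ 0#) refl) (𝟙-no (1# ≟ 0#) (λ 1≡0 → 0≢1 (sym 1≡0))))
                                      (ring (A x) (D x))) ⟩
      sumℤ xs D ∎
      where
        A D : (Fin n → Carrier) → ℤ
        A x = baseCount (zeroPattern (y x))
        D x = excess (zeroPattern (y x))
        ring : ∀ a d → (a ℤ.+ 1ℤ ℤ.* d) ℤ.- (a ℤ.+ 0ℤ ℤ.* d) ≡ d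
        ring = solve-∀

    charPoly-term*q^n : ∀ B → (-1ℤ ℤ.^ card B ℤ.* qℤ ℤ.^ (dualRank (rank F M) fullSet ∸ dualRank (rank F M) B)) ℤ.* qℤ ℤ.^ n
                              ≡ -1ℤ ℤ.^ card B ℤ.* (qℤ ℤ.^ card (complement B) ℤ.* vanishingCount M (complement B))
    charPoly-term*q^n B = begin
      (s ℤ.* qℤ ℤ.^ e) ℤ.* qℤ ℤ.^ n                  ≡⟨ cong ((s ℤ.* qℤ ℤ.^ e) ℤ.*_) (sym (vanishingCount*q^rank M (complement B))) ⟩
      (s ℤ.* qℤ ℤ.^ e) ℤ.* (K ℤ.* qℤ ℤ.^ r′)         ≡⟨ ring s (qℤ ℤ.^ e) K (qℤ ℤ.^ r′) ⟩
      s ℤ.* ((qℤ ℤ.^ e ℤ.* qℤ ℤ.^ r′) ℤ.* K)         ≡⟨ cong (λ t → s ℤ.* (t ℤ.* K)) (sym (ℤₚ.^-distribˡ-+-* qℤ e r′)) ⟩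
      s ℤ.* (qℤ ℤ.^ (e ℕ.+ r′) ℤ.* K)                ≡⟨ cong (λ t → s ℤ.* (qℤ ℤ.^ t ℤ.* K))
                                                           (dualRank-fullSet∸dualRank+rank (rank F M) (rank≤card M)
                                                              (rank-fullSet≤card+rank-complement M) B) ⟩
      s ℤ.* (qℤ ℤ.^ card (complement B) ℤ.* K) ∎
      where
        s = -1ℤ ℤ.^ card B
        e = dualRank (rank F M) fullSet ∸ dualRank (rank F M) B
        r′ = rank F M (complement B)
        K = vanishingCount M (complement B)
        ring : ∀ s P K R → (s ℤ.* P) ℤ.* (K ℤ.* R) ≡ s ℤ.* ((P ℤ.* R) ℤ.* K)
        ring = solve-∀

    charPoly*q^n≡sumℤ-excess : charPoly m (dualRank (rank F M)) qℤ ℤ.* qℤ ℤ.^ n ≡ sumℤ xs (λ x → excess (zeroPattern (y x)))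
    charPoly*q^n≡sumℤ-excess = begin
      charPoly m (dualRank (rank F M)) qℤ ℤ.* qℤ ℤ.^ n     ≡⟨ cong (ℤ._* qℤ ℤ.^ n) (foldr≡sumℤ subsets term) ⟩
      sumℤ subsets term ℤ.* qℤ ℤ.^ n                      ≡⟨ sym (sumℤ-*ʳ subsets (qℤ ℤ.^ n) term) ⟩
      sumℤ subsets (λ B → term B ℤ.* qℤ ℤ.^ n)            ≡⟨ sumℤ-cong subsets charPoly-term*q^n ⟩
      sumℤ subsets (λ B → -1ℤ ℤ.^ card B ℤ.* (qℤ ℤ.^ card (complement B) ℤ.* vanishingCount M (complement B)))
        ≡⟨ sumℤ-cong subsets (λ B → sym (trans (sumℤ-*ˡ xs (-1ℤ ℤ.^ card B) _)
             (cong (ℤ._*_ (-1ℤ ℤ.^ card B)) (sumℤ-*ˡ xs (qℤ ℤ.^ card (complement B)) _)))) ⟩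
      sumℤ subsets (λ B → sumℤ xs (λ x → subsetTerm (y x) B)) ≡⟨ sumℤ-comm subsets xs (λ B x → subsetTerm (y x) B) ⟩
      sumℤ xs (λ x → sumℤ subsets (subsetTerm (y x)))        ≡⟨ sumℤ-cong xs (λ x → sym (excess≡sumℤ-subsetTerm m (y x))) ⟩
      sumℤ xs (λ x → excess (zeroPattern (y x))) ∎
      where
        subsets = allSubsets m
        term : SubsetE m → ℤ
        term B = -1ℤ ℤ.^ card B ℤ.* qℤ ℤ.^ (dualRank (rank F M) fullSet ∸ dualRank (rank F M) B)

open import Data.Integer using (_-_; _*_; _^_)

lemma2 : (F : FiniteField) → OddCharacteristic F →
         (n m : ℕ) (M : Matrix F n m) → FullRowRank F M →
         ((b : Elem F) (j j′ : ℕ) → 1 ≤ j → 1 ≤ j′ → N F M b j ≡ N F M b j′)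
         × ((j : ℕ) → 1 ≤ j →
            charPoly m (dualRank (rank F M)) (pos (FiniteField.size F))
              * (pos (FiniteField.size F)) ^ n
            ≡ pos (N F M (FiniteField.0# F) j) - pos (N F M (FiniteField.1# F) j))
lemma2 F _ n m M _ = N-independent-of-j M , λ j 1≤j → trans (charPoly*q^n≡sumℤ-excess M) (sym (N₀-N₁≡sumℤ-excess M j 1≤j))
  where open Theorem F
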